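{- Let $A=\{a_1\le\dots\le a_n\}$ be a sorted multiset of positive integers and $\varepsilon\in(0,1)$. Let $c=1+\left\lceil\left(1+\frac1\varepsilon\right)\ln\frac{2(k-1)}{\varepsilon^2}\right\rceil$ and $C=(c+1)(k-1)$. Then \[\mathrm{OPT}(A)\le\min_{k\le j\le n}\mathrm{OPT_L}\bigl(A[j-C+1,j]\bigr)\le(1+\varepsilon)\,\mathrm{OPT}(A).\]
   Context: $k\ge2$ is a fixed integer, $[n]=\{1,\dots,n\}$, $\Sigma(S,A)=\sum_{i\in S}a_i$. For pairwise disjoint $S_1,\dots,S_k\subseteq[n]$, with $M=\max_i\Sigma(S_i,A)$, $m=\min_i\Sigma(S_i,A)$, the ratio $\mathcal{R}(S_1,\dots,S_k,A)$ is $M/m$ if $m>0$ and $+\infty$ otherwise. $\mathrm{OPT}(A)$ is the minimum of $\mathcal{R}$ over pairwise disjoint $S_1,\dots,S_k\subseteq[n]$ ($k$-SSR). For a sorted multiset $B$ of size $n'$, $\mathrm{OPT_L}(B)$ is the same minimum for $B$ under the additional constraint that the index $n'$ of the largest element belongs to $\bigcup_iS_i$ ($k$-SSR$_L$). $A[l,r]$ denotes the sorted sub-multiset consisting of the items $a_i$ with $l\le i\le r$ (indices $i<1$ are ignored). A minimum over an empty range is $+\infty$.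
   Formalization: The parameter ε ranges over the rationals in the interval (0,1). -}

module Defs where

open import Data.Nat as ℕ using (ℕ; zero; suc; _∸_; _⊔_; _⊓_)
open import Data.Integer using (+_)
open import Data.Rational as ℚ using (ℚ; 0ℚ; 1ℚ; _/_; 1/_; Positive)
open import Data.Rational.Properties using (pos⇒nonZero; 1/pos⇒pos; pos+pos⇒pos)
open import Data.Fin using (Fin)
open import Data.List using (List; []; _∷_; map; foldr; concatMap; length; take; drop; upTo; allFin; zipWith; sum)
open import Data.Maybe using (Maybe; just; nothing)
open import Data.Bool using (Bool; true; false; if_then_else_)
open import Data.Product using (∃; _×_)
open import Relation.Nullary using (¬_)
open import Data.Empty using (⊥)
open import Data.Unit using (⊤)

data ℚ∞ : Set where
  fin : ℚ → ℚ∞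
  ∞   : ℚ∞

infix 4 _≤∞_
_≤∞_ : ℚ∞ → ℚ∞ → Set
fin p ≤∞ fin q = p ℚ.≤ q
fin p ≤∞ ∞     = ⊤
∞     ≤∞ fin q = ⊥
∞     ≤∞ ∞     = ⊤

min∞ : ℚ∞ → ℚ∞ → ℚ∞
min∞ ∞ y = y
min∞ x ∞ = x
min∞ (fin p) (fin q) = fin (p ℚ.⊓ q)

scale : ℚ → ℚ∞ → ℚ∞
scale r (fin p) = fin (r ℚ.* p)
scale r ∞       = ∞

-- k disjoint subsets S_1..S_k of [n] are encoded as a labelling
-- ℓ : positions 1..n → Maybe (Fin k): ℓ_i = just j iff i ∈ S_j,
-- ℓ_i = nothing iff i ∉ ⋃ S_j.  This is a bijection with k-tuples of
-- pairwise disjoint subsets.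

Labelling : ℕ → Set
Labelling k = List (Maybe (Fin k))

labels : (k : ℕ) → List (Maybe (Fin k))
labels k = nothing ∷ map just (allFin k)

labellings : (k n : ℕ) → List (Labelling k)
labellings k zero    = [] ∷ []
labellings k (suc n) = concatMap (λ l → map (λ x → x ∷ l) (labels k)) (labellings k n)

partSum : ∀ {k} → List ℕ → Labelling k → Fin k → ℕ
partSum (a ∷ as) (just j' ∷ ls) j with Data.Fin._≟_ j j'
... | Relation.Nullary.yes _ = a ℕ.+ partSum as ls j
... | Relation.Nullary.no  _ = partSum as ls j
partSum (a ∷ as) (nothing ∷ ls) j = partSum as ls j
partSum _ _ _ = 0

maxL : List ℕ → ℕ
maxL = foldr _⊔_ 0

minL : List ℕ → ℕ   -- only used on nonempty lists (k ≥ 2)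
minL []       = 0
minL (x ∷ xs) = foldr _⊓_ x xs

ratio : ∀ k → List ℕ → Labelling k → ℚ∞
ratio k A ℓ with minL (map (partSum A ℓ) (allFin k))
... | zero  = ∞
... | suc m = fin ((+ maxL (map (partSum A ℓ) (allFin k))) / suc m)

OPT : ∀ k → List ℕ → ℚ∞
OPT k A = foldr (λ ℓ acc → min∞ (ratio k A ℓ) acc) ∞ (labellings k (length A))

lastUsed : ∀ {k} → Labelling k → Bool
lastUsed []              = false
lastUsed (just _ ∷ [])   = true
lastUsed (nothing ∷ [])  = false
lastUsed (_ ∷ l@(_ ∷ _)) = lastUsed l

OPT-L : ∀ k → List ℕ → ℚ∞
OPT-L k B = foldr (λ ℓ acc → if lastUsed ℓ then min∞ (ratio k B ℓ) acc else acc)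
                  ∞ (labellings k (length B))

-- A[l,r] with l = j - C + 1, r = j  (1-based, indices < 1 ignored)
window : List ℕ → (C j : ℕ) → List ℕ
window A C j = drop (j ∸ C) (take j A)

-- min_{k ≤ j ≤ n} OPT_L(A[j-C+1, j])   (+∞ if the range is empty)
minWindow : ∀ k → (C : ℕ) → List ℕ → ℚ∞
minWindow k C A =
  foldr (λ i acc → min∞ (OPT-L k (window A C (k ℕ.+ i))) acc) ∞
        (upTo (suc (length A) ∸ k))

-- Real-number side condition for c, expressed exactly over ℚ.
-- expApprox y t = Σ_{i=0}^{t} y^i / i!  (Taylor partial sums of e^y).

expTerm : ℚ → ℕ → ℚ
expTerm y zero    = 1ℚ
expTerm y (suc i) = expTerm y i ℚ.* y ℚ.* ((+ 1) / suc i)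

expApprox : ℚ → ℕ → ℚ
expApprox y zero    = 1ℚ
expApprox y (suc t) = expApprox y t ℚ.+ expTerm y (suc t)

-- "r ≤ e^y" for rational y ≥ 0: the partial sums increase to e^y and
-- e^y is irrational for rational y ≠ 0, so r ≤ e^y ⇔ ∃ t, r ≤ expApprox y t.
ExpAtLeast : ℚ → ℚ → Set
ExpAtLeast y r = ∃ λ t → r ℚ.≤ expApprox y t

module _ (k : ℕ) (ε : ℚ) (0<ε : 0ℚ ℚ.< ε) where
  private
    instance
      εpos : Positive ε
      εpos = ℚ.positive 0<ε
      εnz = pos⇒nonZero ε
      invpos : Positive (1/ ε)
      invpos = 1/pos⇒pos ε
    dpos : Positive (1ℚ ℚ.+ 1/ ε)
    dpos = pos+pos⇒pos 1ℚ (1/ ε)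
    instance
      dnz = pos⇒nonZero (1ℚ ℚ.+ 1/ ε) {{dpos}}

  Qk : ℚ
  Qk = ((+ (2 ℕ.* (k ∸ 1))) / 1) ℚ.* (1/ ε) ℚ.* (1/ ε)

  -- "x ≤ m" where x = (1 + 1/ε)·ln(2(k-1)/ε²):
  --   x ≤ m ⇔ ln Q ≤ m/(1+1/ε) ⇔ Q ≤ e^{m/(1+1/ε)}
  LnBoundLe : ℕ → Set
  LnBoundLe m = ExpAtLeast (((+ m) / 1) ℚ.÷ (1ℚ ℚ.+ 1/ ε)) Qk

  -- m = ⌈ (1 + 1/ε)·ln(2(k-1)/ε²) ⌉  (this real is > 0 since k ≥ 2, ε < 1,
  -- so its ceiling is the least natural number ≥ it)
  IsCeilX : ℕ → Set
  IsCeilX m = LnBoundLe m × (∀ m' → m' ℕ.< m → ¬ LnBoundLe m')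

module Submission where

-- Lower bound: a solution on a window, padded with unused positions, is a solution on A with the
-- same parts.
--
-- Upper bound: take a solution on A with smallest part m₀ and largest part M, and let
-- ρ = (1 + ε) M / m₀.  If some k consecutive items satisfy a_i ≤ ρ a_(i-k+1), giving each of them
-- its own part is a solution on the window ending at i of ratio at most ρ.  Otherwise the items grow
-- by a factor ρ every k - 1 steps, so the items before the window ending at the last used position J
-- form a geometric series: their sum L satisfies (ρ - 1) L ≤ (k - 1) ρ a_q with
-- a_q ≤ ρ^-(c+1) a_J ≤ ρ^-(c+1) M.  The choice of c gives 2(k - 1) ≤ ε² e^((c-1)θ) ≤ ε² (1 + ε)^(c-1)
-- for θ = ε / (1 + ε), whence ρ L ≤ ε M.  Restricting the solution to the window lowers each part by
-- at most L, so the restriction has ratio at most M / (m₀ - L) ≤ ρ.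

open import Data.Nat.Base as ℕ using (ℕ; zero; suc; z≤n; s≤s)
open import Data.List.Base using (List)
open import Data.List.Relation.Unary.All using (All)
open import Data.List.Relation.Unary.Linked using (Linked)
open import Data.Bool.Base using (true)
open import Data.Product.Base using (_,_; _×_; proj₁; proj₂)
open import Function.Base using (_∘_)
open import Data.Rational.Base using (ℚ; 0ℚ; 1ℚ; +-*-rawSemiring)
open import Algebra.Definitions.RawSemiring +-*-rawSemiring using (_^_)
open import Relation.Binary.PropositionalEquality using (_≡_; refl; sym; trans; cong; cong₂; subst; subst₂)
open import Defs

-- Rational arithmetic

module _ where
  open import Data.Rational.Base
    using (mkℚ; _/_; 1/_; _+_; _-_; _*_; _≤_; _<_; *≤*; *<*; -_; NonZero; Positive; positive; nonNegative; toℚᵘ)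
  open import Data.Rational.Properties
  open import Data.Rational.Solver using (module +-*-Solver)
  import Data.Rational.Unnormalised as ℚᵘ
  import Data.Rational.Unnormalised.Properties as ℚᵘ
  import Data.Integer.Base as ℤ
  import Data.Integer.Properties as ℤ
  import Data.Nat.Coprimality as Coprime
  import Data.Nat.Properties as ℕ

  -- Written in normal form rather than as ℤ.+ n / 1 (see /≡ι): unfolding the gcd inside _/_ on
  -- open terms makes type checking slow and memory hungry.
  ι : ℕ → ℚ
  ι n = mkℚ (ℤ.+ n) 0 (Coprime.sym (Coprime.1-coprimeTo n))

  /≡ι : ∀ n → ℤ.+ n / 1 ≡ ι n
  /≡ι n = normalize-coprime (Coprime.sym (Coprime.1-coprimeTo n))

  private
    +n*1≡+n : ∀ n → ℤ.+ n ℤ.* ℤ.+ 1 ≡ ℤ.+ n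
    +n*1≡+n n = ℤ.*-identityʳ (ℤ.+ n)

  ι-+ : ∀ a b → ι (a ℕ.+ b) ≡ ι a + ι b
  ι-+ a b = trans (sym (/≡ι (a ℕ.+ b))) (cong (_/ 1) (sym (cong₂ ℤ._+_ (+n*1≡+n a) (+n*1≡+n b))))

  ι-* : ∀ a b → ι (a ℕ.* b) ≡ ι a * ι b
  ι-* a b = trans (sym (/≡ι (a ℕ.* b))) (cong (_/ 1) (ℤ.pos-* a b))

  ι-mono-≤ : ∀ {a b} → a ℕ.≤ b → ι a ≤ ι b
  ι-mono-≤ {a} {b} a≤b = *≤* (subst₂ ℤ._≤_ (sym (+n*1≡+n a)) (sym (+n*1≡+n b)) (ℤ.+≤+ a≤b))

  ι-mono-< : ∀ {a b} → a ℕ.< b → ι a < ι b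
  ι-mono-< {a} {b} a<b = *<* (subst₂ ℤ._<_ (sym (+n*1≡+n a)) (sym (+n*1≡+n b)) (ℤ.+<+ a<b))

  ι-nonNeg : ∀ n → 0ℚ ≤ ι n
  ι-nonNeg n = ι-mono-≤ {0} {n} z≤n

  ι-pos : ∀ n → Positive (ι (suc n))
  ι-pos n = positive (ι-mono-< {0} {suc n} (s≤s z≤n))

  -- ℤ.+ M / suc d is fromℚᵘ of an unnormalised fraction by definition.
  /-*-cancel : ∀ M d → (ℤ.+ M / suc d) * ι (suc d) ≡ ι M
  /-*-cancel M d = toℚᵘ-injective (begin-equality
      toℚᵘ (ℤ.+ M / suc d * ι (suc d))
    ≃⟨ toℚᵘ-homo-* (ℤ.+ M / suc d) (ι (suc d)) ⟩
      toℚᵘ (ℤ.+ M / suc d) ℚᵘ.* ℚᵘ.mkℚᵘ (ℤ.+ suc d) 0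
    ≃⟨ ℚᵘ.*-congʳ (toℚᵘ-fromℚᵘ (ℚᵘ.mkℚᵘ (ℤ.+ M) d)) ⟩
      ℚᵘ.mkℚᵘ (ℤ.+ M) d ℚᵘ.* ℚᵘ.mkℚᵘ (ℤ.+ suc d) 0
    ≃⟨ ℚᵘ.*≡* cross ⟩
      toℚᵘ (ι M) ∎)
    where
    open ℚᵘ.≤-Reasoning
    cross : (ℤ.+ M ℤ.* ℤ.+ suc d) ℤ.* ℤ.+ 1 ≡ ℤ.+ M ℤ.* ℤ.+ (suc d ℕ.* 1)
    cross = trans (ℤ.*-identityʳ _) (cong (λ e → ℤ.+ M ℤ.* ℤ.+ e) (sym (ℕ.*-identityʳ (suc d))))

  1≤M/d : ∀ {M d} → suc d ℕ.≤ M → 1ℚ ≤ ℤ.+ M / suc d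
  1≤M/d {M} {d} d<M = *-cancelʳ-≤-pos (ι (suc d)) {{ι-pos d}}
    (≤-trans (≤-reflexive (*-identityˡ (ι (suc d)))) (≤-trans (ι-mono-≤ d<M) (≤-reflexive (sym (/-*-cancel M d)))))

  *-monoˡ-≤-nonNeg′ : ∀ {r p q} → 0ℚ ≤ r → p ≤ q → r * p ≤ r * q
  *-monoˡ-≤-nonNeg′ {r} 0≤r = *-monoˡ-≤-nonNeg r {{nonNegative 0≤r}}

  *-monoʳ-≤-nonNeg′ : ∀ {r p q} → 0ℚ ≤ r → p ≤ q → p * r ≤ q * r
  *-monoʳ-≤-nonNeg′ {r} 0≤r = *-monoʳ-≤-nonNeg r {{nonNegative 0≤r}}

  *-nonNeg : ∀ {p q} → 0ℚ ≤ p → 0ℚ ≤ q → 0ℚ ≤ p * q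
  *-nonNeg {p} {q} 0≤p 0≤q = ≤-trans (≤-reflexive (sym (*-zeroˡ q))) (*-monoʳ-≤-nonNeg′ 0≤q 0≤p)

  ^-nonNeg : ∀ {a} → 0ℚ ≤ a → ∀ m → 0ℚ ≤ a ^ m
  ^-nonNeg 0≤a zero = ι-nonNeg 1
  ^-nonNeg 0≤a (suc m) = *-nonNeg 0≤a (^-nonNeg 0≤a m)

  ^-monoˡ-≤ : ∀ {a b} → 0ℚ ≤ a → a ≤ b → ∀ m → a ^ m ≤ b ^ m
  ^-monoˡ-≤ 0≤a a≤b zero = ≤-refl
  ^-monoˡ-≤ 0≤a a≤b (suc m) =
    ≤-trans (*-monoʳ-≤-nonNeg′ (^-nonNeg 0≤a m) a≤b)
      (*-monoˡ-≤-nonNeg′ (≤-trans 0≤a a≤b) (^-monoˡ-≤ 0≤a a≤b m))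

  inv-suc : ℕ → ℚ
  inv-suc i = ℤ.+ 1 / suc i

  inv-suc-nonNeg : ∀ i → 0ℚ ≤ inv-suc i
  inv-suc-nonNeg i = nonNegative⁻¹ _ {{normalize-nonNeg 1 (suc i)}}

  inv-suc-telescope : ∀ i → inv-suc i * inv-suc (suc i) + inv-suc (suc i) ≡ inv-suc i
  inv-suc-telescope i = begin-equality
      x * y + y
    ≡⟨ cong (λ z → x * y + z) (trans (cong (y *_) (/-*-cancel 1 i)) (*-identityʳ y)) ⟨
      x * y + y * (x * ι (suc i))
    ≡⟨ solve 3 (λ x y n → x :* y :+ y :* (x :* n) := x :* (y :* (con 1ℚ :+ n))) refl x y (ι (suc i)) ⟩
      x * (y * (1ℚ + ι (suc i)))
    ≡⟨ cong (λ n → x * (y * n)) (ι-+ 1 (suc i)) ⟨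
      x * (y * ι (suc (suc i)))
    ≡⟨ cong (x *_) (/-*-cancel 1 (suc i)) ⟩
      x * 1ℚ
    ≡⟨ *-identityʳ x ⟩
      x ∎
    where
    open ≤-Reasoning
    open +-*-Solver
    x : ℚ
    x = inv-suc i
    y : ℚ
    y = inv-suc (suc i)

  expTerm-nonNeg : ∀ {y} → 0ℚ ≤ y → ∀ i → 0ℚ ≤ expTerm y i
  expTerm-nonNeg 0≤y zero = ι-nonNeg 1
  expTerm-nonNeg 0≤y (suc i) = *-nonNeg (*-nonNeg (expTerm-nonNeg 0≤y i) 0≤y) (inv-suc-nonNeg i)

  module _ {b δ : ℚ} (0≤b : 0ℚ ≤ b) (0≤δ : 0ℚ ≤ δ) where
    private
      a : ℚ
      a = b + δ
      0≤a : 0ℚ ≤ a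
      0≤a = +-mono-≤ 0≤b 0≤δ
      b≤a : b ≤ a
      b≤a = ≤-trans (≤-reflexive (sym (+-identityʳ b))) (+-monoʳ-≤ b 0≤δ)
      open ≤-Reasoning
      open +-*-Solver

    -- In closed form: (b + δ)ⁱ⁺¹ - bⁱ⁺¹ ≤ (i + 1) δ (b + δ)ⁱ.
    expTerm-suc-+-≤ : ∀ i → expTerm a (suc i) ≤ expTerm b (suc i) + δ * expTerm a i
    expTerm-suc-+-≤ zero = ≤-reflexive
      (solve 2 (λ b δ → con 1ℚ :* (b :+ δ) :* con 1ℚ := con 1ℚ :* b :* con 1ℚ :+ δ :* con 1ℚ) refl b δ)
    expTerm-suc-+-≤ (suc i) = begin
        u′ * a * w
      ≡⟨ solve 4 (λ u′ b δ w → u′ :* (b :+ δ) :* w := (u′ :* δ :+ u′ :* b) :* w) refl u′ b δ w ⟩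
        (u′ * δ + u′ * b) * w
      ≤⟨ *-monoʳ-≤-nonNeg′ (inv-suc-nonNeg (suc i))
           (+-monoʳ-≤ (u′ * δ) (*-monoʳ-≤-nonNeg′ 0≤b (expTerm-suc-+-≤ i))) ⟩
        (u′ * δ + (v′ + δ * u) * b) * w
      ≡⟨ solve 6 (λ u′ δ v′ u b w →
                   (u′ :* δ :+ (v′ :+ δ :* u) :* b) :* w := v′ :* b :* w :+ δ :* (u′ :* w :+ u :* b :* w))
               refl u′ δ v′ u b w ⟩
        v′ * b * w + δ * (u′ * w + u * b * w)
      ≤⟨ +-monoʳ-≤ (v′ * b * w) (*-monoˡ-≤-nonNeg′ 0≤δ (+-monoʳ-≤ (u′ * w)
           (*-monoʳ-≤-nonNeg′ (inv-suc-nonNeg (suc i)) (*-monoˡ-≤-nonNeg′ (expTerm-nonNeg 0≤a i) b≤a)))) ⟩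
        v′ * b * w + δ * (u′ * w + u * a * w)
      ≡⟨ cong (λ z → v′ * b * w + δ * z) (begin-equality
          u * a * inv-suc i * w + u * a * w
        ≡⟨ solve 3 (λ ua x y → ua :* x :* y :+ ua :* y := ua :* (x :* y :+ y)) refl (u * a) (inv-suc i) w ⟩
          u * a * (inv-suc i * w + w)
        ≡⟨ cong (u * a *_) (inv-suc-telescope i) ⟩
          u′ ∎) ⟩
        v′ * b * w + δ * u′ ∎
      where
      u : ℚ
      u = expTerm a i
      u′ : ℚ
      u′ = expTerm a (suc i)
      v′ : ℚ
      v′ = expTerm b (suc i)
      w : ℚ
      w = inv-suc (suc i)

    expApprox-+-≤ : ∀ t → (1ℚ - δ) * expApprox a t ≤ expApprox b t
    expApprox-+-≤ t = begin
        (1ℚ - δ) * E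
      ≡⟨ solve 2 (λ δ E → (con 1ℚ :- δ) :* E := E :- δ :* E) refl δ E ⟩
        E - δ * E
      ≤⟨ +-monoˡ-≤ (- (δ * E))
           (≤-trans (≤-reflexive (sym (+-identityʳ E))) (+-monoʳ-≤ E (*-nonNeg 0≤δ (expTerm-nonNeg 0≤a t)))) ⟩
        E + δ * expTerm a t - δ * E
      ≤⟨ +-monoˡ-≤ (- (δ * E)) (with-last-term t) ⟩
        expApprox b t + δ * E - δ * E
      ≡⟨ solve 2 (λ x y → x :+ y :- y := x) refl (expApprox b t) (δ * E) ⟩
        expApprox b t ∎
      where
      E : ℚ
      E = expApprox a t
      with-last-term : ∀ t → expApprox a t + δ * expTerm a t ≤ expApprox b t + δ * expApprox a t
      with-last-term zero = ≤-refl
      with-last-term (suc t) = begin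
          expApprox a t + Tᵃ + δ * Tᵃ
        ≤⟨ +-monoˡ-≤ (δ * Tᵃ) (+-monoʳ-≤ (expApprox a t) (expTerm-suc-+-≤ t)) ⟩
          expApprox a t + (Tᵇ + δ * expTerm a t) + δ * Tᵃ
        ≡⟨ solve 5 (λ E T′ δ T Tᵃ → E :+ (T′ :+ δ :* T) :+ δ :* Tᵃ := (E :+ δ :* T) :+ T′ :+ δ :* Tᵃ)
                 refl (expApprox a t) Tᵇ δ (expTerm a t) Tᵃ ⟩
          (expApprox a t + δ * expTerm a t) + Tᵇ + δ * Tᵃ
        ≤⟨ +-monoˡ-≤ (δ * Tᵃ) (+-monoˡ-≤ Tᵇ (with-last-term t)) ⟩
          (expApprox b t + δ * expApprox a t) + Tᵇ + δ * Tᵃ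
        ≡⟨ solve 5 (λ Eᵇ E δ T′ Tᵃ → (Eᵇ :+ δ :* E) :+ T′ :+ δ :* Tᵃ := (Eᵇ :+ T′) :+ δ :* (E :+ Tᵃ))
                 refl (expApprox b t) (expApprox a t) δ Tᵇ Tᵃ ⟩
          expApprox b (suc t) + δ * expApprox a (suc t) ∎
        where
        Tᵃ : ℚ
        Tᵃ = expTerm a (suc t)
        Tᵇ : ℚ
        Tᵇ = expTerm b (suc t)

  expApprox-0 : ∀ t → expApprox 0ℚ t ≡ 1ℚ
  expApprox-0 zero = refl
  expApprox-0 (suc t) = begin-equality
      expApprox 0ℚ t + expTerm 0ℚ t * 0ℚ * inv-suc t
    ≡⟨ cong₂ (λ E T → E + T * inv-suc t) (expApprox-0 t) (*-zeroʳ (expTerm 0ℚ t)) ⟩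
      1ℚ + 0ℚ * inv-suc t
    ≡⟨ cong (1ℚ +_) (*-zeroˡ (inv-suc t)) ⟩
      1ℚ ∎
    where open ≤-Reasoning

  module _ {ε : ℚ} (0<ε : 0ℚ < ε) where
    private
      instance
        ε-pos : Positive ε
        ε-pos = positive 0<ε
        ε-nonZero : NonZero ε
        ε-nonZero = pos⇒nonZero ε
        1/ε-pos : Positive (1/ ε)
        1/ε-pos = 1/pos⇒pos ε
      1+1/ε-pos : Positive (1ℚ + 1/ ε)
      1+1/ε-pos = pos+pos⇒pos 1ℚ (1/ ε)
      instance
        1+1/ε-nonZero : NonZero (1ℚ + 1/ ε)
        1+1/ε-nonZero = pos⇒nonZero (1ℚ + 1/ ε) {{1+1/ε-pos}}
      open ≤-Reasoning
      open +-*-Solver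

      θ : ℚ
      θ = 1/ (1ℚ + 1/ ε)

      0≤θ : 0ℚ ≤ θ
      0≤θ = nonNegative⁻¹ θ {{pos⇒nonNeg θ {{1/pos⇒pos (1ℚ + 1/ ε) {{1+1/ε-pos}}}}}}

      [1+ε]*θ≡ε : (1ℚ + ε) * θ ≡ ε
      [1+ε]*θ≡ε = begin-equality
          (1ℚ + ε) * θ
        ≡⟨ cong (λ z → (z + ε) * θ) (*-inverseʳ ε) ⟨
          (ε * 1/ ε + ε) * θ
        ≡⟨ solve 3 (λ e e⁻¹ t → (e :* e⁻¹ :+ e) :* t := e :* ((con 1ℚ :+ e⁻¹) :* t)) refl ε (1/ ε) θ ⟩
          ε * ((1ℚ + 1/ ε) * θ)
        ≡⟨ cong (ε *_) (*-inverseʳ (1ℚ + 1/ ε)) ⟩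
          ε * 1ℚ
        ≡⟨ *-identityʳ ε ⟩
          ε ∎

      [1+ε][1-θ]≡1 : (1ℚ + ε) * (1ℚ - θ) ≡ 1ℚ
      [1+ε][1-θ]≡1 = begin-equality
          (1ℚ + ε) * (1ℚ - θ)
        ≡⟨ solve 2 (λ e t → (con 1ℚ :+ e) :* (con 1ℚ :- t) := con 1ℚ :+ e :- (con 1ℚ :+ e) :* t) refl ε θ ⟩
          1ℚ + ε - (1ℚ + ε) * θ
        ≡⟨ cong (λ e → 1ℚ + ε - e) [1+ε]*θ≡ε ⟩
          1ℚ + ε - ε
        ≡⟨ solve 1 (λ e → con 1ℚ :+ e :- e := con 1ℚ) refl ε ⟩
          1ℚ ∎

    -- e^θ ≤ 1 / (1 - θ) = 1 + ε, applied to the partial sums one factor at a time.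
    expApprox-≤-[1+ε]^ : ∀ m t → expApprox (ι m * θ) t ≤ (1ℚ + ε) ^ m
    expApprox-≤-[1+ε]^ zero t = ≤-reflexive (trans (cong (λ y → expApprox y t) (*-zeroˡ θ)) (expApprox-0 t))
    expApprox-≤-[1+ε]^ (suc m) t = begin
        expApprox (ι (1 ℕ.+ m) * θ) t
      ≡⟨ cong (λ y → expApprox y t) ι[1+m]θ≡ ⟩
        E
      ≡⟨ trans (cong (_* E) [1+ε][1-θ]≡1) (*-identityˡ E) ⟨
        (1ℚ + ε) * (1ℚ - θ) * E
      ≡⟨ *-assoc (1ℚ + ε) (1ℚ - θ) E ⟩
        (1ℚ + ε) * ((1ℚ - θ) * E)
      ≤⟨ *-monoˡ-≤-nonNeg′ 0≤1+ε (expApprox-+-≤ 0≤ιmθ 0≤θ t) ⟩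
        (1ℚ + ε) * expApprox (ι m * θ) t
      ≤⟨ *-monoˡ-≤-nonNeg′ 0≤1+ε (expApprox-≤-[1+ε]^ m t) ⟩
        (1ℚ + ε) * (1ℚ + ε) ^ m ∎
      where
      E : ℚ
      E = expApprox (ι m * θ + θ) t
      0≤ιmθ : 0ℚ ≤ ι m * θ
      0≤ιmθ = *-nonNeg (ι-nonNeg m) 0≤θ
      0≤1+ε : 0ℚ ≤ 1ℚ + ε
      0≤1+ε = +-mono-≤ (ι-nonNeg 1) (<⇒≤ 0<ε)
      ι[1+m]θ≡ : ι (1 ℕ.+ m) * θ ≡ ι m * θ + θ
      ι[1+m]θ≡ = trans (cong (_* θ) (ι-+ 1 m)) (solve 2 (λ n t → (con 1ℚ :+ n) :* t := n :* t :+ t) refl (ι m) θ)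

    LnBoundLe⇒2[k-1]≤ε²[1+ε]^m : ∀ k m → LnBoundLe k ε 0<ε m → ι (2 ℕ.* (k ℕ.∸ 1)) ≤ ε * ε * (1ℚ + ε) ^ m
    LnBoundLe⇒2[k-1]≤ε²[1+ε]^m k m (t , Q≤E) = begin
        ι N
      ≡⟨ ε²Q≡N ⟨
        ε * ε * (ι N * 1/ ε * 1/ ε)
      ≤⟨ *-monoˡ-≤-nonNeg′ 0≤ε² (subst₂ _≤_ (cong (λ q → q * 1/ ε * 1/ ε) (/≡ι N))
                                            (cong (λ y → expApprox (y * θ) t) (/≡ι m)) Q≤E) ⟩
        ε * ε * expApprox (ι m * θ) t
      ≤⟨ *-monoˡ-≤-nonNeg′ 0≤ε² (expApprox-≤-[1+ε]^ m t) ⟩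
        ε * ε * (1ℚ + ε) ^ m ∎
      where
      N : ℕ
      N = 2 ℕ.* (k ℕ.∸ 1)
      0≤ε² : 0ℚ ≤ ε * ε
      0≤ε² = *-nonNeg (<⇒≤ 0<ε) (<⇒≤ 0<ε)
      ε²Q≡N : ε * ε * (ι N * 1/ ε * 1/ ε) ≡ ι N
      ε²Q≡N = begin-equality
          ε * ε * (ι N * 1/ ε * 1/ ε)
        ≡⟨ solve 3 (λ e n e⁻¹ → e :* e :* (n :* e⁻¹ :* e⁻¹) := n :* (e :* e⁻¹) :* (e :* e⁻¹))
                 refl ε (ι N) (1/ ε) ⟩
          ι N * (ε * 1/ ε) * (ε * 1/ ε)
        ≡⟨ cong (λ z → ι N * z * z) (*-inverseʳ ε) ⟩
          ι N * 1ℚ * 1ℚ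
        ≡⟨ trans (*-identityʳ _) (*-identityʳ _) ⟩
          ι N ∎

  1+ε≤ρ⇒ε≤ρ-1 : ∀ {ε ρ} → 1ℚ + ε ≤ ρ → ε ≤ ρ - 1ℚ
  1+ε≤ρ⇒ε≤ρ-1 {ε} {ρ} 1+ε≤ρ = begin
      ε
    ≡⟨ solve 1 (λ e → e := (con 1ℚ :+ e) :- con 1ℚ) refl ε ⟩
      1ℚ + ε - 1ℚ
    ≤⟨ +-monoˡ-≤ (- 1ℚ) 1+ε≤ρ ⟩
      ρ - 1ℚ ∎
    where
    open ≤-Reasoning
    open +-*-Solver

  module _ {ε ρ : ℚ} (0<ε : 0ℚ < ε) (1+ε≤ρ : 1ℚ + ε ≤ ρ) where
    private
      open ≤-Reasoning
      open +-*-Solver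
      0≤ε : 0ℚ ≤ ε
      0≤ε = <⇒≤ 0<ε
      0≤ρ : 0ℚ ≤ ρ
      0≤ρ = ≤-trans (+-mono-≤ (ι-nonNeg 1) 0≤ε) 1+ε≤ρ

    -- Since ε ≤ ρ - 1, the three hypotheses chain into ε ρ S ≤ ε² ρ^(m+2) x ≤ ε² M.
    ρS≤εM : ∀ {S x M K} m → 0ℚ ≤ S → 0ℚ ≤ x →
      S * (ρ - 1ℚ) ≤ K * ρ * x → ρ ^ (2 ℕ.+ m) * x ≤ M → K ≤ ε * ε * (1ℚ + ε) ^ m →
      ρ * S ≤ ε * M
    ρS≤εM {S} {x} {M} {K} m 0≤S 0≤x S[ρ-1]≤Kρx ρ^[2+m]x≤M K≤ε²[1+ε]^m = *-cancelˡ-≤-pos ε (begin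
        ε * (ρ * S)
      ≤⟨ *-monoʳ-≤-nonNeg′ (*-nonNeg 0≤ρ 0≤S) (1+ε≤ρ⇒ε≤ρ-1 {ε} 1+ε≤ρ) ⟩
        (ρ - 1ℚ) * (ρ * S)
      ≡⟨ solve 3 (λ r s ρ → r :* (ρ :* s) := ρ :* (s :* r)) refl (ρ - 1ℚ) S ρ ⟩
        ρ * (S * (ρ - 1ℚ))
      ≤⟨ *-monoˡ-≤-nonNeg′ 0≤ρ S[ρ-1]≤Kρx ⟩
        ρ * (K * ρ * x)
      ≡⟨ solve 3 (λ ρ K x → ρ :* (K :* ρ :* x) := K :* (ρ :* ρ :* x)) refl ρ K x ⟩
        K * (ρ * ρ * x)
      ≤⟨ *-monoʳ-≤-nonNeg′ 0≤ρ²x K≤ε²[1+ε]^m ⟩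
        ε * ε * (1ℚ + ε) ^ m * (ρ * ρ * x)
      ≤⟨ *-monoʳ-≤-nonNeg′ 0≤ρ²x (*-monoˡ-≤-nonNeg′ (*-nonNeg 0≤ε 0≤ε)
           (^-monoˡ-≤ (+-mono-≤ (ι-nonNeg 1) 0≤ε) 1+ε≤ρ m)) ⟩
        ε * ε * ρ ^ m * (ρ * ρ * x)
      ≡⟨ solve 4 (λ e p ρ x → e :* e :* p :* (ρ :* ρ :* x) := e :* (e :* (ρ :* (ρ :* p) :* x))) refl ε (ρ ^ m) ρ x ⟩
        ε * (ε * (ρ ^ (2 ℕ.+ m) * x))
      ≤⟨ *-monoˡ-≤-nonNeg′ 0≤ε (*-monoˡ-≤-nonNeg′ 0≤ε ρ^[2+m]x≤M) ⟩
        ε * (ε * M) ∎)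
      where
      instance
        ε-pos : Positive ε
        ε-pos = positive 0<ε
      0≤ρ²x : 0ℚ ≤ ρ * ρ * x
      0≤ρ²x = *-nonNeg (*-nonNeg 0≤ρ 0≤ρ) 0≤x

  prefix-removal-bound : ∀ {ε ρ M} L m₀ → 0ℚ < M → 0ℚ ≤ ρ →
    ρ * ι L ≤ ε * M → ρ * ι m₀ ≡ (1ℚ + ε) * M →
    L ℕ.< m₀ × M ≤ ρ * ι (m₀ ℕ.∸ L)
  prefix-removal-bound {ε} {ρ} {M} L m₀ 0<M 0≤ρ ρL≤εM ρm₀≡[1+ε]M = L<m₀ , M≤ρ[m₀-L]
    where
    open ≤-Reasoning
    open +-*-Solver
    εM<ρm₀ : ε * M < ρ * ι m₀
    εM<ρm₀ = begin-strict
        ε * M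
      <⟨ ≤-<-trans (≤-reflexive (sym (+-identityˡ _))) (+-monoˡ-< (ε * M) 0<M) ⟩
        M + ε * M
      ≡⟨ solve 2 (λ M e → M :+ e :* M := (con 1ℚ :+ e) :* M) refl M ε ⟩
        (1ℚ + ε) * M
      ≡⟨ ρm₀≡[1+ε]M ⟨
        ρ * ι m₀ ∎
    L<m₀ : L ℕ.< m₀
    L<m₀ = ℕ.≰⇒> λ m₀≤L →
      <-irrefl refl (<-≤-trans εM<ρm₀ (≤-trans (*-monoˡ-≤-nonNeg′ 0≤ρ (ι-mono-≤ m₀≤L)) ρL≤εM))
    M≤ρ[m₀-L] : M ≤ ρ * ι (m₀ ℕ.∸ L)
    M≤ρ[m₀-L] = begin
        M
      ≡⟨ solve 2 (λ M e → M := (con 1ℚ :+ e) :* M :- e :* M) refl M ε ⟩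
        (1ℚ + ε) * M - ε * M
      ≡⟨ cong (_- ε * M) ρm₀≡[1+ε]M ⟨
        ρ * ι m₀ - ε * M
      ≤⟨ +-monoʳ-≤ (ρ * ι m₀) (neg-antimono-≤ ρL≤εM) ⟩
        ρ * ι m₀ - ρ * ι L
      ≡⟨ cong (λ z → ρ * z - ρ * ι L) (trans (cong ι (sym (ℕ.m∸n+n≡m (ℕ.<⇒≤ L<m₀)))) (ι-+ (m₀ ℕ.∸ L) L)) ⟩
        ρ * (ι (m₀ ℕ.∸ L) + ι L) - ρ * ι L
      ≡⟨ solve 3 (λ r a b → r :* (a :+ b) :- r :* b := r :* a) refl ρ (ι (m₀ ℕ.∸ L)) (ι L) ⟩
        ρ * ι (m₀ ℕ.∸ L) ∎

module _ where
  import Data.Rational.Properties as ℚ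
  open import Data.Unit.Base using (tt)
  open import Data.Sum.Base using (_⊎_; inj₁; inj₂)

  ≤∞-refl : ∀ {x} → x ≤∞ x
  ≤∞-refl {fin p} = ℚ.≤-refl
  ≤∞-refl {∞} = tt

  ≤∞-reflexive : ∀ {x y} → x ≡ y → x ≤∞ y
  ≤∞-reflexive refl = ≤∞-refl

  ≤∞-trans : ∀ {x y z} → x ≤∞ y → y ≤∞ z → x ≤∞ z
  ≤∞-trans {fin p} {fin q} {fin r} p≤q q≤r = ℚ.≤-trans p≤q q≤r
  ≤∞-trans {fin p} {fin q} {∞} _ _ = tt
  ≤∞-trans {fin p} {∞} {∞} _ _ = tt
  ≤∞-trans {∞} {∞} {∞} _ _ = tt

  x≤∞∞ : ∀ {x} → x ≤∞ ∞
  x≤∞∞ {fin p} = tt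
  x≤∞∞ {∞} = tt

  min∞-≤ˡ : ∀ x y → min∞ x y ≤∞ x
  min∞-≤ˡ ∞ y = x≤∞∞
  min∞-≤ˡ (fin p) ∞ = ℚ.≤-refl
  min∞-≤ˡ (fin p) (fin q) = ℚ.p⊓q≤p p q

  min∞-≤ʳ : ∀ x y → min∞ x y ≤∞ y
  min∞-≤ʳ ∞ y = ≤∞-refl
  min∞-≤ʳ (fin p) ∞ = tt
  min∞-≤ʳ (fin p) (fin q) = ℚ.p⊓q≤q p q

  min∞-glb : ∀ {z} x y → z ≤∞ x → z ≤∞ y → z ≤∞ min∞ x y
  min∞-glb ∞ y _ z≤y = z≤y
  min∞-glb (fin p) ∞ z≤p _ = z≤p
  min∞-glb {fin r} (fin p) (fin q) r≤p r≤q = ℚ.⊓-glb r≤p r≤q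

  min∞-sel : ∀ x y → min∞ x y ≡ x ⊎ min∞ x y ≡ y
  min∞-sel ∞ y = inj₂ refl
  min∞-sel (fin p) ∞ = inj₁ refl
  min∞-sel (fin p) (fin q) with ℚ.⊓-sel p q
  ... | inj₁ p⊓q≡p = inj₁ (cong fin p⊓q≡p)
  ... | inj₂ p⊓q≡q = inj₂ (cong fin p⊓q≡q)

module _ where
  open import Data.Nat.Base using (_+_; _∸_; _≤_)
  open import Data.Nat.Properties using (suc-injective; m+[n∸m]≡n; ∸-monoˡ-<)
  open import Data.Bool.Base using (Bool; true; false; if_then_else_)
  open import Data.Fin.Base using (Fin)
  open import Data.List.Base using ([]; _∷_; map; foldr; length; upTo)
  open import Data.List.Membership.Propositional using (_∈_; find)
  open import Data.List.Membership.Propositional.Properties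
    using (∈-allFin; ∈-map⁺; ∈-map⁻; ∈-concatMap⁺; ∈-concatMap⁻; ∈-upTo⁺)
  open import Data.List.Relation.Unary.Any as Any using (here; there)
  open import Data.Maybe.Base using (Maybe; just; nothing)
  open import Data.Sum.Base using (inj₁; inj₂)

  private
    foldMin : {X : Set} → (X → ℚ∞) → List X → ℚ∞
    foldMin f = foldr (λ x acc → min∞ (f x) acc) ∞

    foldMin-≤ : ∀ {X} (f : X → ℚ∞) {x xs} → x ∈ xs → foldMin f xs ≤∞ f x
    foldMin-≤ f {xs = y ∷ ys} (here refl) = min∞-≤ˡ (f y) (foldMin f ys)
    foldMin-≤ f {xs = y ∷ ys} (there x∈ys) = ≤∞-trans (min∞-≤ʳ (f y) (foldMin f ys)) (foldMin-≤ f x∈ys)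

    ≤-foldMin : ∀ {X} (f : X → ℚ∞) {z} xs → (∀ {x} → x ∈ xs → z ≤∞ f x) → z ≤∞ foldMin f xs
    ≤-foldMin f [] _ = x≤∞∞
    ≤-foldMin f (y ∷ ys) z≤ = min∞-glb (f y) (foldMin f ys) (z≤ (here refl)) (≤-foldMin f ys (z≤ ∘ there))

    -- Scaling commutes with the minimum because min∞ returns one of its arguments.
    ≤-scale-foldMin : ∀ {X} (f : X → ℚ∞) {z} c xs → (∀ {x} → x ∈ xs → z ≤∞ scale c (f x)) →
      z ≤∞ scale c (foldMin f xs)
    ≤-scale-foldMin f c [] _ = x≤∞∞
    ≤-scale-foldMin f c (y ∷ ys) z≤ with min∞-sel (f y) (foldMin f ys)
    ... | inj₁ min≡fy rewrite min≡fy = z≤ (here refl)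
    ... | inj₂ min≡rest rewrite min≡rest = ≤-scale-foldMin f c ys (z≤ ∘ there)

    foldMinIf : {X : Set} → (X → Bool) → (X → ℚ∞) → List X → ℚ∞
    foldMinIf b f = foldr (λ x acc → if b x then min∞ (f x) acc else acc) ∞

    foldMinIf-≤ : ∀ {X} b (f : X → ℚ∞) {x xs} → x ∈ xs → b x ≡ true → foldMinIf b f xs ≤∞ f x
    foldMinIf-≤ b f {xs = y ∷ ys} (here refl) bx rewrite bx = min∞-≤ˡ (f y) (foldMinIf b f ys)
    foldMinIf-≤ b f {xs = y ∷ ys} (there x∈ys) bx with b y
    ... | true = ≤∞-trans (min∞-≤ʳ (f y) (foldMinIf b f ys)) (foldMinIf-≤ b f x∈ys bx)
    ... | false = foldMinIf-≤ b f x∈ys bx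

    ≤-foldMinIf : ∀ {X} b (f : X → ℚ∞) {z} xs → (∀ {x} → x ∈ xs → b x ≡ true → z ≤∞ f x) →
      z ≤∞ foldMinIf b f xs
    ≤-foldMinIf b f [] _ = x≤∞∞
    ≤-foldMinIf b f (y ∷ ys) z≤ with b y in by
    ... | true = min∞-glb (f y) (foldMinIf b f ys) (z≤ (here refl) by) (≤-foldMinIf b f ys (z≤ ∘ there))
    ... | false = ≤-foldMinIf b f ys (z≤ ∘ there)

    ∈-labels : ∀ {k} (x : Maybe (Fin k)) → x ∈ labels k
    ∈-labels nothing = here refl
    ∈-labels (just i) = there (∈-map⁺ just (∈-allFin i))

  ∈-labellings : ∀ {k n} (ℓ : Labelling k) → length ℓ ≡ n → ℓ ∈ labellings k n
  ∈-labellings {n = zero} [] _ = here refl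
  ∈-labellings {k} {suc n} (x ∷ ℓ) |ℓ|≡n = ∈-concatMap⁺ (λ l → map (_∷ l) (labels k))
    (Any.map (λ { refl → ∈-map⁺ (_∷ ℓ) (∈-labels x) }) (∈-labellings {n = n} ℓ (suc-injective |ℓ|≡n)))

  ∈-labellings⁻ : ∀ {k} n {ℓ : Labelling k} → ℓ ∈ labellings k n → length ℓ ≡ n
  ∈-labellings⁻ zero (here refl) = refl
  ∈-labellings⁻ {k} (suc n) ℓ∈ with find (∈-concatMap⁻ (λ l → map (_∷ l) (labels k)) {xs = labellings k n} ℓ∈)
  ... | ℓ′ , ℓ′∈ , ℓ∈ℓ′ with ∈-map⁻ (_∷ ℓ′) ℓ∈ℓ′
  ... | _ , _ , refl = cong suc (∈-labellings⁻ n ℓ′∈)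

  OPT-≤ : ∀ k A (ℓ : Labelling k) → length ℓ ≡ length A → OPT k A ≤∞ ratio k A ℓ
  OPT-≤ k A ℓ |ℓ|≡|A| = foldMin-≤ (ratio k A) (∈-labellings ℓ |ℓ|≡|A|)

  ≤-scale-OPT : ∀ k A {z} c → (∀ (ℓ : Labelling k) → length ℓ ≡ length A → z ≤∞ scale c (ratio k A ℓ)) →
    z ≤∞ scale c (OPT k A)
  ≤-scale-OPT k A c z≤ = ≤-scale-foldMin (ratio k A) c (labellings k (length A))
    (λ ℓ∈ → z≤ _ (∈-labellings⁻ (length A) ℓ∈))

  OPT-L-≤ : ∀ k B (ℓ : Labelling k) → length ℓ ≡ length B → lastUsed ℓ ≡ true → OPT-L k B ≤∞ ratio k B ℓ
  OPT-L-≤ k B ℓ |ℓ|≡|B| = foldMinIf-≤ lastUsed (ratio k B) (∈-labellings ℓ |ℓ|≡|B|)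

  ≤-OPT-L : ∀ k B {z} → (∀ (ℓ : Labelling k) → length ℓ ≡ length B → lastUsed ℓ ≡ true → z ≤∞ ratio k B ℓ) →
    z ≤∞ OPT-L k B
  ≤-OPT-L k B z≤ = ≤-foldMinIf lastUsed (ratio k B) (labellings k (length B))
    (λ ℓ∈ → z≤ _ (∈-labellings⁻ (length B) ℓ∈))

  minWindow-≤ : ∀ k C A {j} → k ≤ j → j ≤ length A → minWindow k C A ≤∞ OPT-L k (window A C j)
  minWindow-≤ k C A {j} k≤j j≤|A| = subst (λ i → minWindow k C A ≤∞ OPT-L k (window A C i)) (m+[n∸m]≡n k≤j)
    (foldMin-≤ (λ i → OPT-L k (window A C (k + i))) (∈-upTo⁺ (∸-monoˡ-< (s≤s j≤|A|) k≤j)))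

  minWindow-≤-ratio : ∀ {k} C A {j} (ℓ : Labelling k) → k ≤ j → j ≤ length A →
    length ℓ ≡ length (window A C j) → lastUsed ℓ ≡ true → minWindow k C A ≤∞ ratio k (window A C j) ℓ
  minWindow-≤-ratio {k} C A ℓ k≤j j≤|A| |ℓ|≡|W| last-used =
    ≤∞-trans (minWindow-≤ k C A k≤j j≤|A|) (OPT-L-≤ k _ ℓ |ℓ|≡|W| last-used)

  ≤-minWindow : ∀ k C A {z} → (∀ j → z ≤∞ OPT-L k (window A C j)) → z ≤∞ minWindow k C A
  ≤-minWindow k C A z≤ = ≤-foldMin (λ i → OPT-L k (window A C (k + i))) (upTo (suc (length A) ∸ k)) (λ {i} _ → z≤ (k + i))

module _ where
  open import Data.Nat.Base using (_+_; _⊓_; _≤_; _<_)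
  open import Data.Nat.Properties
  open import Data.Nat.ListAction using (sum)
  open import Data.Fin as Fin using (Fin; toℕ)
  import Data.Fin.Properties as Fin
  open import Data.List.Base using ([]; _∷_; _++_; map; foldr; take; drop; replicate; length; lookup; allFin; tabulate)
  open import Data.List.Membership.Propositional using (_∈_)
  open import Data.List.Properties using (length-map)
  open import Data.List.Membership.Propositional.Properties using (∈-map⁺; ∈-allFin)
  open import Data.List.Relation.Unary.Any using (here; there; index)
  open import Data.List.Relation.Unary.Any.Properties using (lookup-index)
  open import Data.Maybe.Base as Maybe using (just; nothing)
  open import Data.Maybe.Properties using (just-injective)
  open import Relation.Nullary.Decidable using (yes; no)
  open import Relation.Nullary.Negation using (contradiction)

  -- Indexing from 0, with junk value 0 past the end.
  at : List ℕ → ℕ → ℕ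
  at [] _ = 0
  at (x ∷ xs) zero = x
  at (x ∷ xs) (suc i) = at xs i

  singletons : ∀ k → Labelling k
  singletons zero = []
  singletons (suc k) = just Fin.zero ∷ map (Maybe.map Fin.suc) (singletons k)

  length-singletons : ∀ k → length (singletons k) ≡ k
  length-singletons zero = refl
  length-singletons (suc k) = cong suc (trans (length-map _ (singletons k)) (length-singletons k))

  lastUsed-++ : ∀ {k} (xs ys : Labelling k) → 0 < length ys → lastUsed (xs ++ ys) ≡ lastUsed ys
  lastUsed-++ [] ys _ = refl
  lastUsed-++ (just _ ∷ []) (y ∷ ys) _ = refl
  lastUsed-++ (nothing ∷ []) (y ∷ ys) _ = refl
  lastUsed-++ (just _ ∷ x ∷ xs) ys 0<|ys| = lastUsed-++ (x ∷ xs) ys 0<|ys|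
  lastUsed-++ (nothing ∷ x ∷ xs) ys 0<|ys| = lastUsed-++ (x ∷ xs) ys 0<|ys|

  lastUsed-drop : ∀ {k} d (xs : Labelling k) → d < length xs → lastUsed (drop d xs) ≡ lastUsed xs
  lastUsed-drop zero xs _ = refl
  lastUsed-drop (suc d) (just _ ∷ x ∷ xs) (s≤s d<|xs|) = lastUsed-drop d (x ∷ xs) d<|xs|
  lastUsed-drop (suc d) (nothing ∷ x ∷ xs) (s≤s d<|xs|) = lastUsed-drop d (x ∷ xs) d<|xs|

  lastUsed-singletons : ∀ k → lastUsed (singletons (suc k)) ≡ true
  lastUsed-singletons zero = refl
  lastUsed-singletons (suc k) = trans (lastUsed-map (singletons (suc k))) (lastUsed-singletons k)
    where
    lastUsed-map : ∀ {k} (ℓ : Labelling k) → lastUsed (map (Maybe.map Fin.suc) ℓ) ≡ lastUsed ℓ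
    lastUsed-map [] = refl
    lastUsed-map (just _ ∷ []) = refl
    lastUsed-map (nothing ∷ []) = refl
    lastUsed-map (just _ ∷ x ∷ ℓ) = lastUsed-map (x ∷ ℓ)
    lastUsed-map (nothing ∷ x ∷ ℓ) = lastUsed-map (x ∷ ℓ)

  module _ {k : ℕ} where
    private
      partSum-[] : ∀ xs (t : Fin k) → partSum xs [] t ≡ 0
      partSum-[] [] t = refl
      partSum-[] (x ∷ xs) t = refl

    partSum-nothings : ∀ xs n (t : Fin k) → partSum xs (replicate n nothing) t ≡ 0
    partSum-nothings [] n t = refl
    partSum-nothings (x ∷ xs) zero t = refl
    partSum-nothings (x ∷ xs) (suc n) t = partSum-nothings xs n t

    partSum-take-drop : ∀ n xs (ℓ : Labelling k) t →
      partSum xs ℓ t ≡ partSum (take n xs) (take n ℓ) t + partSum (drop n xs) (drop n ℓ) t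
    partSum-take-drop zero xs ℓ t = refl
    partSum-take-drop (suc n) [] ℓ t = refl
    partSum-take-drop (suc n) (x ∷ xs) [] t = sym (partSum-[] (drop n xs) t)
    partSum-take-drop (suc n) (x ∷ xs) (nothing ∷ ℓ) t = partSum-take-drop n xs ℓ t
    partSum-take-drop (suc n) (x ∷ xs) (just u ∷ ℓ) t with t Fin.≟ u
    ... | yes _ = trans (cong (x +_) (partSum-take-drop n xs ℓ t)) (sym (+-assoc x _ _))
    ... | no _ = partSum-take-drop n xs ℓ t

    partSum-padded : ∀ P W Q (ℓ : Labelling k) t → length W ≡ length ℓ →
      partSum (P ++ W ++ Q) (replicate (length P) nothing ++ ℓ ++ replicate (length Q) nothing) t ≡ partSum W ℓ t
    partSum-padded (x ∷ P) W Q ℓ t |W|≡|ℓ| = partSum-padded P W Q ℓ t |W|≡|ℓ|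
    partSum-padded [] [] Q [] t _ = partSum-nothings Q (length Q) t
    partSum-padded [] (w ∷ W) Q (nothing ∷ ℓ) t |W|≡|ℓ| = partSum-padded [] W Q ℓ t (suc-injective |W|≡|ℓ|)
    partSum-padded [] (w ∷ W) Q (just u ∷ ℓ) t |W|≡|ℓ| with t Fin.≟ u
    ... | yes _ = cong (w +_) (partSum-padded [] W Q ℓ t (suc-injective |W|≡|ℓ|))
    ... | no _ = partSum-padded [] W Q ℓ t (suc-injective |W|≡|ℓ|)

    partSum-≤-sum : ∀ xs (ℓ : Labelling k) t → partSum xs ℓ t ≤ sum xs
    partSum-≤-sum [] ℓ t = z≤n
    partSum-≤-sum (x ∷ xs) [] t = z≤n
    partSum-≤-sum (x ∷ xs) (nothing ∷ ℓ) t = ≤-trans (partSum-≤-sum xs ℓ t) (m≤n+m _ x)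
    partSum-≤-sum (x ∷ xs) (just u ∷ ℓ) t with t Fin.≟ u
    ... | yes _ = +-monoʳ-≤ x (partSum-≤-sum xs ℓ t)
    ... | no _ = ≤-trans (partSum-≤-sum xs ℓ t) (m≤n+m _ x)

    at-≤-partSum : ∀ xs (pre : Labelling k) t rest → at xs (length pre) ≤ partSum xs (pre ++ just t ∷ rest) t
    at-≤-partSum [] pre t rest = z≤n
    at-≤-partSum (x ∷ xs) [] t rest with t Fin.≟ t
    ... | yes _ = m≤m+n x _
    ... | no t≢t = contradiction refl t≢t
    at-≤-partSum (x ∷ xs) (nothing ∷ pre) t rest = at-≤-partSum xs pre t rest
    at-≤-partSum (x ∷ xs) (just u ∷ pre) t rest with t Fin.≟ u
    ... | yes _ = ≤-trans (at-≤-partSum xs pre t rest) (m≤n+m _ x)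
    ... | no _ = at-≤-partSum xs pre t rest

    partSum-pos⇒∈ : ∀ xs (ℓ : Labelling k) t → 0 < partSum xs ℓ t → just t ∈ ℓ
    partSum-pos⇒∈ (x ∷ xs) (nothing ∷ ℓ) t 0<ps = there (partSum-pos⇒∈ xs ℓ t 0<ps)
    partSum-pos⇒∈ (x ∷ xs) (just u ∷ ℓ) t 0<ps with t Fin.≟ u
    ... | yes refl = here refl
    ... | no _ = there (partSum-pos⇒∈ xs ℓ t 0<ps)

  private
    partSum-shift : ∀ {k} xs (ℓ : Labelling k) t → partSum xs (map (Maybe.map Fin.suc) ℓ) (Fin.suc t) ≡ partSum xs ℓ t
    partSum-shift [] ℓ t = refl
    partSum-shift (x ∷ xs) [] t = refl
    partSum-shift (x ∷ xs) (nothing ∷ ℓ) t = partSum-shift xs ℓ t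
    partSum-shift (x ∷ xs) (just u ∷ ℓ) t with t Fin.≟ u | Fin.suc t Fin.≟ Fin.suc u
    ... | yes _ | yes _ = cong (x +_) (partSum-shift xs ℓ t)
    ... | no _ | no _ = partSum-shift xs ℓ t
    ... | yes t≡u | no t≢u = contradiction (cong Fin.suc t≡u) t≢u
    ... | no t≢u | yes t≡u = contradiction (Fin.suc-injective t≡u) t≢u

    partSum-shift-zero : ∀ {k} xs (ℓ : Labelling k) → partSum xs (map (Maybe.map Fin.suc) ℓ) Fin.zero ≡ 0
    partSum-shift-zero [] ℓ = refl
    partSum-shift-zero (x ∷ xs) [] = refl
    partSum-shift-zero (x ∷ xs) (nothing ∷ ℓ) = partSum-shift-zero xs ℓ
    partSum-shift-zero (x ∷ xs) (just u ∷ ℓ) = partSum-shift-zero xs ℓ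

    partSum-singletons : ∀ {k} xs (t : Fin k) → partSum xs (singletons k) t ≡ at xs (toℕ t)
    partSum-singletons [] t = refl
    partSum-singletons (x ∷ xs) Fin.zero = trans (cong (x +_) (partSum-shift-zero xs _)) (+-identityʳ x)
    partSum-singletons (x ∷ xs) (Fin.suc t) = trans (partSum-shift xs _ t) (partSum-singletons xs t)

  partSum-padded-singletons : ∀ {k} xs r (t : Fin k) →
    partSum xs (replicate r nothing ++ singletons k) t ≡ at xs (r + toℕ t)
  partSum-padded-singletons xs zero t = partSum-singletons xs t
  partSum-padded-singletons [] (suc r) t = refl
  partSum-padded-singletons (x ∷ xs) (suc r) t = partSum-padded-singletons xs r t

  all-labels⇒k≤length : ∀ {k} (ℓ : Labelling k) → (∀ t → just t ∈ ℓ) → k ≤ length ℓ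
  all-labels⇒k≤length ℓ just∈ℓ = Fin.injective⇒≤ {f = λ t → index (just∈ℓ t)} λ {t} {u} same-index →
    just-injective (trans (lookup-index (just∈ℓ t)) (trans (cong (lookup ℓ) same-index) (sym (lookup-index (just∈ℓ u)))))

  parts : ∀ {k} → List ℕ → Labelling k → List ℕ
  parts {k} A ℓ = map (partSum A ℓ) (allFin k)

  partSum-≤-maxL : ∀ {k} A (ℓ : Labelling k) t → partSum A ℓ t ≤ maxL (parts A ℓ)
  partSum-≤-maxL A ℓ t = ≤-maxL (∈-map⁺ (partSum A ℓ) (∈-allFin t))
    where
    ≤-maxL : ∀ {x xs} → x ∈ xs → x ≤ maxL xs
    ≤-maxL {xs = y ∷ ys} (here refl) = m≤m⊔n y _
    ≤-maxL {xs = y ∷ ys} (there x∈ys) = ≤-trans (≤-maxL x∈ys) (m≤n⊔m y _)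

  minL-≤-partSum : ∀ {k} A (ℓ : Labelling k) t → minL (parts A ℓ) ≤ partSum A ℓ t
  minL-≤-partSum A ℓ t = minL-≤ (∈-map⁺ (partSum A ℓ) (∈-allFin t))
    where
    foldr⊓-≤ : ∀ y ys → foldr _⊓_ y ys ≤ y
    foldr⊓-≤ y [] = ≤-refl
    foldr⊓-≤ y (z ∷ zs) = ≤-trans (m⊓n≤n z _) (foldr⊓-≤ y zs)
    foldr⊓-≤-∈ : ∀ {x} y ys → x ∈ ys → foldr _⊓_ y ys ≤ x
    foldr⊓-≤-∈ y (z ∷ zs) (here refl) = m⊓n≤m z _
    foldr⊓-≤-∈ y (z ∷ zs) (there x∈zs) = ≤-trans (m⊓n≤n z _) (foldr⊓-≤-∈ y zs x∈zs)
    minL-≤ : ∀ {x xs} → x ∈ xs → minL xs ≤ x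
    minL-≤ {xs = y ∷ ys} (here refl) = foldr⊓-≤ y ys
    minL-≤ {xs = y ∷ ys} (there x∈ys) = foldr⊓-≤-∈ y ys x∈ys

  maxL-≤ : ∀ {k} A (ℓ : Labelling k) {hi} → (∀ t → partSum A ℓ t ≤ hi) → maxL (parts A ℓ) ≤ hi
  maxL-≤ {k} A ℓ {hi} ≤hi = go (allFin k)
    where
    go : ∀ ts → maxL (map (partSum A ℓ) ts) ≤ hi
    go [] = z≤n
    go (t ∷ ts) = ⊔-lub (≤hi t) (go ts)

  ≤-minL : ∀ {k} A (ℓ : Labelling (suc k)) {lo} → (∀ t → lo ≤ partSum A ℓ t) → lo ≤ minL (parts A ℓ)
  ≤-minL A ℓ {lo} lo≤ = go (tabulate Fin.suc)
    where
    go : ∀ ts → lo ≤ foldr _⊓_ (partSum A ℓ Fin.zero) (map (partSum A ℓ) ts)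
    go [] = lo≤ Fin.zero
    go (t ∷ ts) = ⊓-glb (lo≤ t) (go ts)

module _ where
  open import Data.Rational.Base using (_/_; _*_; _≤_)
  open import Data.Rational.Properties using (*-cancelʳ-≤-pos; module ≤-Reasoning)
  import Data.Integer.Base as ℤ
  import Data.Nat.Base as ℕ
  open import Data.Nat.Properties using (≤-trans)
  open import Data.List.Base using (allFin)
  open import Data.List.Properties using (map-cong)
  open import Relation.Nullary.Negation using (contradiction)

  private
    ratioOf : ℕ → ℕ → ℚ∞
    ratioOf M zero = ∞
    ratioOf M (suc m) = fin (ℤ.+ M / suc m)

    ratio≡ratioOf : ∀ k A (ℓ : Labelling k) → ratio k A ℓ ≡ ratioOf (maxL (parts A ℓ)) (minL (parts A ℓ))
    ratio≡ratioOf k A ℓ with minL (parts A ℓ)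
    ... | zero = refl
    ... | suc m = refl

  ratio-cong : ∀ k A B (ℓ ℓ′ : Labelling k) → (∀ t → partSum A ℓ t ≡ partSum B ℓ′ t) →
    ratio k A ℓ ≡ ratio k B ℓ′
  ratio-cong k A B ℓ ℓ′ same-parts =
    trans (ratio≡ratioOf k A ℓ)
      (trans (cong (λ xs → ratioOf (maxL xs) (minL xs)) (map-cong same-parts (allFin k)))
        (sym (ratio≡ratioOf k B ℓ′)))

  ratio-≤ : ∀ {k} B (ℓ : Labelling (suc k)) {lo hi ρ} → 0 ℕ.< lo →
    (∀ t → lo ℕ.≤ partSum B ℓ t) → (∀ t → partSum B ℓ t ℕ.≤ hi) →
    0ℚ ≤ ρ → ι hi ≤ ρ * ι lo → ratio (suc k) B ℓ ≤∞ fin ρ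
  ratio-≤ {k} B ℓ {lo} {hi} {ρ} 0<lo lo≤ ≤hi 0≤ρ hi≤ρlo
    rewrite ratio≡ratioOf (suc k) B ℓ with minL (parts B ℓ) | ≤-minL B ℓ lo≤
  ... | zero | lo≤0 = contradiction (≤-trans 0<lo lo≤0) λ ()
  ... | suc m | lo≤1+m = *-cancelʳ-≤-pos (ι (suc m)) {{ι-pos m}} (begin
      (ℤ.+ M / suc m) * ι (suc m)
    ≡⟨ /-*-cancel M m ⟩
      ι M
    ≤⟨ ι-mono-≤ (maxL-≤ B ℓ ≤hi) ⟩
      ι hi
    ≤⟨ hi≤ρlo ⟩
      ρ * ι lo
    ≤⟨ *-monoˡ-≤-nonNeg′ 0≤ρ (ι-mono-≤ lo≤1+m) ⟩
      ρ * ι (suc m) ∎)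
    where
    open ≤-Reasoning
    M : ℕ
    M = maxL (parts B ℓ)

-- The lower bound

module _ where
  open import Data.Nat.Base using (_+_; _∸_)
  open import Data.List.Base using (_++_; take; drop; replicate; length)
  open import Data.List.Properties using (++-assoc; take++drop≡id; length-++; length-replicate)
  open import Data.Maybe.Base using (nothing)
  open import Relation.Binary.PropositionalEquality using (module ≡-Reasoning)

  OPT-≤-OPT-L-window : ∀ k A C j → OPT k A ≤∞ OPT-L k (window A C j)
  OPT-≤-OPT-L-window k A C j = ≤-OPT-L k W λ ℓ |ℓ|≡|W| _ →
    ≤∞-trans (OPT-≤ k A (padded ℓ) (length-padded ℓ |ℓ|≡|W|))
      (≤∞-reflexive (ratio-cong k A W (padded ℓ) ℓ λ t →
        trans (cong (λ A′ → partSum A′ (padded ℓ) t) (sym A-split)) (partSum-padded P W Q ℓ t (sym |ℓ|≡|W|))))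
    where
    open ≡-Reasoning
    P : List ℕ
    P = take (j ∸ C) (take j A)
    W : List ℕ
    W = window A C j
    Q : List ℕ
    Q = drop j A
    A-split : P ++ W ++ Q ≡ A
    A-split = trans (sym (++-assoc P W Q)) (trans (cong (_++ Q) (take++drop≡id (j ∸ C) (take j A))) (take++drop≡id j A))
    padded : Labelling k → Labelling k
    padded ℓ = replicate (length P) nothing ++ ℓ ++ replicate (length Q) nothing
    length-padded : ∀ ℓ → length ℓ ≡ length W → length (padded ℓ) ≡ length A
    length-padded ℓ |ℓ|≡|W| = begin
        length (padded ℓ)
      ≡⟨ length-++ (replicate (length P) nothing) ⟩
        length (replicate (length P) nothing) + length (ℓ ++ replicate (length Q) nothing)
      ≡⟨ cong₂ _+_ (length-replicate (length P)) (trans (length-++ ℓ) (cong₂ _+_ |ℓ|≡|W| (length-replicate (length Q)))) ⟩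
        length P + (length W + length Q)
      ≡⟨ trans (length-++ P) (cong (length P +_) (length-++ W)) ⟨
        length (P ++ W ++ Q)
      ≡⟨ cong length A-split ⟩
        length A ∎

  OPT-≤-minWindow : ∀ k C A → OPT k A ≤∞ minWindow k C A
  OPT-≤-minWindow k C A = ≤-minWindow k C A (OPT-≤-OPT-L-window k A C)

module _ where
  open import Data.Nat.Base using (_+_; _*_; _∸_; _≤_; _<_; s≤s⁻¹)
  open import Data.Nat.Properties
  open import Data.Nat.ListAction using (sum)
  open import Data.List.Base using ([]; _∷_; _++_; take; drop; replicate; length)
  open import Data.List.Properties using (length-take; length-drop; take-take)
  open import Data.Maybe.Base using (just; nothing)
  open import Data.Product.Base using (∃-syntax)
  open import Data.Sum.Base using (_⊎_; inj₁; inj₂)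
  open import Data.List.Relation.Unary.All using (All; _∷_)
  open import Relation.Binary.PropositionalEquality using (module ≡-Reasoning)
  open import Data.List.Relation.Unary.Linked using (Linked; _∷_)

  at-drop : ∀ xs d p → at (drop d xs) p ≡ at xs (d + p)
  at-drop xs zero p = refl
  at-drop [] (suc d) p = refl
  at-drop (x ∷ xs) (suc d) p = at-drop xs d p

  at-take : ∀ xs j p → p < j → at (take j xs) p ≡ at xs p
  at-take [] (suc j) p _ = refl
  at-take (x ∷ xs) (suc j) zero _ = refl
  at-take (x ∷ xs) (suc j) (suc p) (s≤s p<j) = at-take xs j p p<j

  at-window : ∀ A C j p → j ∸ C + p < j → at (window A C j) p ≡ at A (j ∸ C + p)
  at-window A C j p <j = trans (at-drop (take j A) (j ∸ C) p) (at-take A j (j ∸ C + p) <j)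

  at-pos : ∀ {A} → All (0 <_) A → ∀ {i} → i < length A → 0 < at A i
  at-pos (a⁺ ∷ _) {zero} _ = a⁺
  at-pos (_ ∷ A⁺) {suc i} (s≤s i<n) = at-pos A⁺ i<n

  at-mono : ∀ {A} → Linked _≤_ A → ∀ {i i′} → i ≤ i′ → i′ < length A → at A i ≤ at A i′
  at-mono {x ∷ xs} A↗ {zero} {zero} _ _ = ≤-refl
  at-mono {x ∷ y ∷ ys} (x≤y ∷ A↗) {zero} {suc i′} _ (s≤s i′<n) = ≤-trans x≤y (at-mono A↗ z≤n i′<n)
  at-mono {x ∷ y ∷ ys} (_ ∷ A↗) {suc i} {suc i′} (s≤s i≤i′) (s≤s i′<n) = at-mono A↗ i≤i′ i′<n

  sum-take-suc : ∀ xs q → q < length xs → sum (take (suc q) xs) ≡ sum (take q xs) + at xs q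
  sum-take-suc (x ∷ xs) zero _ = +-comm x 0
  sum-take-suc (x ∷ xs) (suc q) (s≤s q<n) = trans (cong (x +_) (sum-take-suc xs q q<n)) (sym (+-assoc x _ _))

  sum-take-≤ : ∀ {A} → Linked _≤_ A → ∀ q r {p} → q + r ≤ suc p → p < length A →
    sum (take (q + r) A) ≤ sum (take q A) + r * at A p
  sum-take-≤ {A} A↗ q zero _ _ = ≤-reflexive (trans (cong (λ i → sum (take i A)) (+-identityʳ q)) (sym (+-identityʳ _)))
  sum-take-≤ {A} A↗ q (suc r) {p} q+r<1+p p<n = begin
      sum (take (q + suc r) A)
    ≡⟨ cong (λ i → sum (take i A)) (+-suc q r) ⟩
      sum (take (suc (q + r)) A)
    ≡⟨ sum-take-suc A (q + r) (≤-<-trans q+r≤p p<n) ⟩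
      sum (take (q + r) A) + at A (q + r)
    ≤⟨ +-mono-≤ (sum-take-≤ A↗ q r (m≤n⇒m≤1+n q+r≤p) p<n) (at-mono A↗ q+r≤p p<n) ⟩
      sum (take q A) + r * at A p + at A p
    ≡⟨ trans (+-assoc (sum (take q A)) _ _) (cong (sum (take q A) +_) (+-comm (r * at A p) (at A p))) ⟩
      sum (take q A) + suc r * at A p ∎
    where
    open ≤-Reasoning
    q+r≤p : q + r ≤ p
    q+r≤p = s≤s⁻¹ (subst (_≤ suc p) (+-suc q r) q+r<1+p)

  length-take-≤ : ∀ {X : Set} j (xs : List X) → j ≤ length xs → length (take j xs) ≡ j
  length-take-≤ j xs j≤|xs| = trans (length-take j xs) (m≤n⇒m⊓n≡m j≤|xs|)

  windowL : ∀ {k} → Labelling k → (C j : ℕ) → Labelling k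
  windowL ℓ C j = drop (j ∸ C) (take j ℓ)

  module _ {k} (A : List ℕ) (ℓ : Labelling k) (C j : ℕ) where
    length-windowL : j ≤ length A → j ≤ length ℓ → length (windowL ℓ C j) ≡ length (window A C j)
    length-windowL j≤|A| j≤|ℓ| = begin
        length (drop (j ∸ C) (take j ℓ))
      ≡⟨ length-drop (j ∸ C) (take j ℓ) ⟩
        length (take j ℓ) ∸ (j ∸ C)
      ≡⟨ cong (_∸ (j ∸ C)) (trans (length-take-≤ j ℓ j≤|ℓ|) (sym (length-take-≤ j A j≤|A|))) ⟩
        length (take j A) ∸ (j ∸ C)
      ≡⟨ length-drop (j ∸ C) (take j A) ⟨
        length (drop (j ∸ C) (take j A)) ∎
      where open ≡-Reasoning

    partSum-windowL-≤ : ∀ t → partSum (window A C j) (windowL ℓ C j) t ≤ partSum (take j A) (take j ℓ) t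
    partSum-windowL-≤ t = subst (partSum (window A C j) (windowL ℓ C j) t ≤_)
      (sym (partSum-take-drop (j ∸ C) (take j A) (take j ℓ) t)) (m≤n+m _ _)

    partSum-≤-windowL : ∀ t →
      partSum (take j A) (take j ℓ) t ≤ sum (take (j ∸ C) A) + partSum (window A C j) (windowL ℓ C j) t
    partSum-≤-windowL t = begin
        partSum (take j A) (take j ℓ) t
      ≡⟨ partSum-take-drop (j ∸ C) (take j A) (take j ℓ) t ⟩
        partSum (take (j ∸ C) (take j A)) (take (j ∸ C) (take j ℓ)) t + partSum (window A C j) (windowL ℓ C j) t
      ≤⟨ +-monoˡ-≤ _ (partSum-≤-sum (take (j ∸ C) (take j A)) _ t) ⟩
        sum (take (j ∸ C) (take j A)) + partSum (window A C j) (windowL ℓ C j) t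
      ≡⟨ cong (λ P → sum P + partSum (window A C j) (windowL ℓ C j) t)
           (trans (take-take (j ∸ C) j A) (cong (λ i → take i A) (m≤n⇒m⊓n≡m (m∸n≤m j C)))) ⟩
        sum (take (j ∸ C) A) + partSum (window A C j) (windowL ℓ C j) t ∎
      where open ≤-Reasoning

  lastUsed-windowL : ∀ {k} (ℓ : Labelling k) {C j} → 0 < C → 0 < j → j ≤ length ℓ →
    lastUsed (take j ℓ) ≡ true → lastUsed (windowL ℓ C j) ≡ true
  lastUsed-windowL ℓ {suc C} {suc J} _ _ j≤|ℓ| last-used =
    trans (lastUsed-drop (J ∸ C) (take (suc J) ℓ)
             (subst (J ∸ C <_) (sym (length-take-≤ (suc J) ℓ j≤|ℓ|)) (s≤s (m∸n≤m J C))))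
      last-used

  take-++-∷ : ∀ {X : Set} (xs : List X) y ys → take (suc (length xs)) (xs ++ y ∷ ys) ≡ xs ++ y ∷ []
  take-++-∷ [] y ys = refl
  take-++-∷ (x ∷ xs) y ys = cong (x ∷_) (take-++-∷ xs y ys)

  drop-++-∷ : ∀ {X : Set} (xs : List X) y ys → drop (suc (length xs)) (xs ++ y ∷ ys) ≡ ys
  drop-++-∷ [] y ys = refl
  drop-++-∷ (x ∷ xs) y ys = drop-++-∷ xs y ys

  lastLabel : ∀ {k} (ℓ : Labelling k) →
    ℓ ≡ replicate (length ℓ) nothing ⊎ ∃[ pre ] ∃[ t ] ∃[ r ] ℓ ≡ pre ++ just t ∷ replicate r nothing
  lastLabel [] = inj₁ refl
  lastLabel (x ∷ ℓ) with lastLabel ℓ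
  ... | inj₂ (pre , t , r , ℓ≡) = inj₂ (x ∷ pre , t , r , cong (x ∷_) ℓ≡)
  lastLabel (nothing ∷ ℓ) | inj₁ ℓ≡ = inj₁ (cong (nothing ∷_) ℓ≡)
  lastLabel (just t ∷ ℓ) | inj₁ ℓ≡ = inj₂ ([] , t , length ℓ , cong (just t ∷_) ℓ≡)

-- The upper bound

module _ {k′ : ℕ} {A : List ℕ} (A↗ : Linked ℕ._≤_ A) (A⁺ : All (0 ℕ.<_) A) where
  open import Data.Rational.Base using (_/_; _+_; _-_; _*_; -_; _≤_; _<_)
  import Data.Integer.Base as ℤ
  open import Data.Rational.Properties
    using (≤-trans; ≤-reflexive; <⇒≤; +-mono-≤; +-monoˡ-≤; +-monoʳ-≤; +-identityʳ;
           *-identityˡ; *-identityʳ; *-zeroʳ; *-assoc; nonPositive⁻¹; _≤?_; ≰⇒>; module ≤-Reasoning)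
  open import Data.Nat.Induction using (<-rec)
  open import Relation.Nullary.Decidable using (Dec; yes; no; _×-dec_)
  open import Data.Rational.Solver using (module +-*-Solver)
  open import Data.Nat.Properties as ℕ using (≤-<-trans; m∸n≤m)
  open import Data.Fin.Base using (toℕ)
  open import Data.Fin.Properties using (toℕ≤pred[n])
  open import Data.Nat.ListAction using (sum)
  open import Data.List.Base using ([]; _∷_; _++_; take; drop; replicate; length)
  open import Data.List.Properties using (length-++; length-replicate; length-drop)
  open import Data.Maybe.Base using (just; nothing)
  open import Data.Fin.Base as Fin using ()
  open import Data.Sum.Base using (inj₁; inj₂)
  open import Relation.Nullary.Negation using (contradiction)
  open import Relation.Binary.PropositionalEquality using (module ≡-Reasoning)

  private
    k : ℕ
    k = suc k′
    n : ℕ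
    n = length A

  minWindow-≤-flat : ∀ {C ρ} i → k ℕ.≤ C → 0ℚ ≤ ρ → k′ ℕ.≤ i → i ℕ.< n →
    ι (at A i) ≤ ρ * ι (at A (i ℕ.∸ k′)) → minWindow k C A ≤∞ fin ρ
  minWindow-≤-flat {C} {ρ} i k≤C 0≤ρ k′≤i i<n flat =
    ≤∞-trans (minWindow-≤-ratio C A ℓ k≤j i<n |ℓ|≡|W| last-used)
      (ratio-≤ W ℓ (at-pos A⁺ (≤-<-trans (m∸n≤m i k′) i<n)) first≤part part≤last 0≤ρ flat)
    where
    j : ℕ
    j = suc i
    d : ℕ
    d = j ℕ.∸ C
    W : List ℕ
    W = window A C j
    k≤j : k ℕ.≤ j
    k≤j = s≤s k′≤i
    |W|≡j∸d : length W ≡ j ℕ.∸ d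
    |W|≡j∸d = trans (length-drop d (take j A)) (cong (ℕ._∸ d) (length-take-≤ j A i<n))
    k≤|W| : k ℕ.≤ length W
    k≤|W| = begin
        k                   ≡⟨ ℕ.m∸[m∸n]≡n k≤j ⟨
        j ℕ.∸ (j ℕ.∸ k)     ≤⟨ ℕ.∸-monoʳ-≤ j (ℕ.∸-monoʳ-≤ j k≤C) ⟩
        j ℕ.∸ d             ≡⟨ |W|≡j∸d ⟨
        length W            ∎
      where open ℕ.≤-Reasoning
    r : ℕ
    r = length W ℕ.∸ k
    ℓ : Labelling k
    ℓ = replicate r nothing ++ singletons k
    |ℓ|≡|W| : length ℓ ≡ length W
    |ℓ|≡|W| = trans (length-++ (replicate r nothing))
      (trans (cong₂ ℕ._+_ (length-replicate r) (length-singletons k)) (ℕ.m∸n+n≡m k≤|W|))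
    last-used : lastUsed ℓ ≡ true
    last-used = trans (lastUsed-++ (replicate r nothing) (singletons k) (s≤s z≤n)) (lastUsed-singletons k′)
    position≤i : ∀ t → i ℕ.∸ k′ ℕ.+ toℕ t ℕ.≤ i
    position≤i t = ℕ.≤-trans (ℕ.+-monoʳ-≤ (i ℕ.∸ k′) (toℕ≤pred[n] t)) (ℕ.≤-reflexive (ℕ.m∸n+n≡m k′≤i))
    position : ∀ t → d ℕ.+ (r ℕ.+ toℕ t) ≡ i ℕ.∸ k′ ℕ.+ toℕ t
    position t = begin
        d ℕ.+ (r ℕ.+ toℕ t)                   ≡⟨ ℕ.+-assoc d r (toℕ t) ⟨
        d ℕ.+ (length W ℕ.∸ k) ℕ.+ toℕ t     ≡⟨ cong (ℕ._+ toℕ t) (ℕ.+-∸-assoc d k≤|W|) ⟨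
        d ℕ.+ length W ℕ.∸ k ℕ.+ toℕ t       ≡⟨ cong (λ w → d ℕ.+ w ℕ.∸ k ℕ.+ toℕ t) |W|≡j∸d ⟩
        d ℕ.+ (j ℕ.∸ d) ℕ.∸ k ℕ.+ toℕ t      ≡⟨ cong (λ w → w ℕ.∸ k ℕ.+ toℕ t) (ℕ.m+[n∸m]≡n (m∸n≤m j C)) ⟩
        j ℕ.∸ k ℕ.+ toℕ t                    ∎
      where open ≡-Reasoning
    position<j : ∀ t → d ℕ.+ (r ℕ.+ toℕ t) ℕ.< j
    position<j t = subst (ℕ._< j) (sym (position t)) (s≤s (position≤i t))
    part≡ : ∀ t → partSum W ℓ t ≡ at A (i ℕ.∸ k′ ℕ.+ toℕ t)
    part≡ t = begin
        partSum W ℓ t                        ≡⟨ partSum-padded-singletons W r t ⟩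
        at W (r ℕ.+ toℕ t)                   ≡⟨ at-window A C j (r ℕ.+ toℕ t) (position<j t) ⟩
        at A (d ℕ.+ (r ℕ.+ toℕ t))           ≡⟨ cong (at A) (position t) ⟩
        at A (i ℕ.∸ k′ ℕ.+ toℕ t)            ∎
      where open ≡-Reasoning
    first≤part : ∀ t → at A (i ℕ.∸ k′) ℕ.≤ partSum W ℓ t
    first≤part t = subst (at A (i ℕ.∸ k′) ℕ.≤_) (sym (part≡ t))
      (at-mono A↗ (ℕ.m≤m+n (i ℕ.∸ k′) (toℕ t)) (≤-<-trans (position≤i t) i<n))
    part≤last : ∀ t → partSum W ℓ t ℕ.≤ at A i
    part≤last t = subst (ℕ._≤ at A i) (sym (part≡ t)) (at-mono A↗ (position≤i t) i<n)

  minWindow-≤-prefix-window : ∀ {C ρ m₀ M} (ℓ : Labelling k) j → 0 ℕ.< C → length ℓ ≡ n → j ℕ.≤ n →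
    lastUsed (take j ℓ) ≡ true →
    0 ℕ.< m₀ → (∀ t → m₀ ℕ.≤ partSum (take j A) (take j ℓ) t) →
    (∀ t → partSum (take j A) (take j ℓ) t ℕ.≤ M) →
    sum (take (j ℕ.∸ C) A) ℕ.< m₀ → 0ℚ ≤ ρ → ι M ≤ ρ * ι (m₀ ℕ.∸ sum (take (j ℕ.∸ C) A)) →
    minWindow k C A ≤∞ fin ρ
  minWindow-≤-prefix-window {C} {ρ} {m₀} {M} ℓ zero _ _ _ () 
  minWindow-≤-prefix-window {C} {ρ} {m₀} {M} ℓ j@(suc _) 0<C |ℓ|≡n j≤n last-used 0<m₀ m₀≤ ≤M L<m₀ 0≤ρ
                            M≤ρ[m₀-L] =
    ≤∞-trans (minWindow-≤-ratio C A (windowL ℓ C j) k≤j j≤n (length-windowL A ℓ C j j≤n j≤|ℓ|)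
                                (lastUsed-windowL ℓ 0<C (s≤s z≤n) j≤|ℓ| last-used))
      (ratio-≤ (window A C j) (windowL ℓ C j) (ℕ.m<n⇒0<n∸m L<m₀) lower upper 0≤ρ M≤ρ[m₀-L])
    where
    L : ℕ
    L = sum (take (j ℕ.∸ C) A)
    j≤|ℓ| : j ℕ.≤ length ℓ
    j≤|ℓ| = subst (j ℕ.≤_) (sym |ℓ|≡n) j≤n
    k≤j : k ℕ.≤ j
    k≤j = subst (k ℕ.≤_) (length-take-≤ j ℓ j≤|ℓ|) (all-labels⇒k≤length (take j ℓ)
      λ t → partSum-pos⇒∈ (take j A) (take j ℓ) t (ℕ.<-≤-trans 0<m₀ (m₀≤ t)))
    lower : ∀ t → m₀ ℕ.∸ L ℕ.≤ partSum (window A C j) (windowL ℓ C j) t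
    lower t = ℕ.m≤n+o⇒m∸n≤o m₀ L (ℕ.≤-trans (m₀≤ t) (partSum-≤-windowL A ℓ C j t))
    upper : ∀ t → partSum (window A C j) (windowL ℓ C j) t ℕ.≤ M
    upper t = ℕ.≤-trans (partSum-windowL-≤ A ℓ C j t) (≤M t)

  module _ {ε ρ : ℚ} (0<ε : 0ℚ < ε) (1+ε≤ρ : 1ℚ + ε ≤ ρ) (1≤k′ : 1 ℕ.≤ k′)
           (growing : ∀ i → k′ ℕ.≤ i → i ℕ.< n → ρ * ι (at A (i ℕ.∸ k′)) < ι (at A i)) where
    private
      open ≤-Reasoning
      open +-*-Solver
      0≤ε : 0ℚ ≤ ε
      0≤ε = <⇒≤ 0<ε
      0≤ρ : 0ℚ ≤ ρ
      0≤ρ = ≤-trans (+-mono-≤ (ι-nonNeg 1) 0≤ε) 1+ε≤ρ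
      0≤ρ-1 : 0ℚ ≤ ρ - 1ℚ
      0≤ρ-1 = ≤-trans 0≤ε (1+ε≤ρ⇒ε≤ρ-1 {ε} 1+ε≤ρ)
      ρ-1≤ρ : ρ - 1ℚ ≤ ρ
      ρ-1≤ρ = ≤-trans (+-monoʳ-≤ ρ (nonPositive⁻¹ (- 1ℚ))) (≤-reflexive (+-identityʳ ρ))

    growing-iterate : ∀ s J → s ℕ.* k′ ℕ.≤ J → J ℕ.< n → ρ ^ s * ι (at A (J ℕ.∸ s ℕ.* k′)) ≤ ι (at A J)
    growing-iterate zero J _ _ = ≤-reflexive (*-identityˡ _)
    growing-iterate (suc s) J [1+s]k′≤J J<n = begin
        ρ * ρ ^ s * ι (at A (J ℕ.∸ (k′ ℕ.+ s ℕ.* k′)))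
      ≡⟨ cong (λ p → ρ * ρ ^ s * ι (at A p))
           (trans (cong (J ℕ.∸_) (ℕ.+-comm k′ (s ℕ.* k′))) (sym (ℕ.∸-+-assoc J (s ℕ.* k′) k′))) ⟩
        ρ * ρ ^ s * ι (at A (i ℕ.∸ k′))
      ≡⟨ solve 3 (λ r p x → r :* p :* x := p :* (r :* x)) refl ρ (ρ ^ s) (ι (at A (i ℕ.∸ k′))) ⟩
        ρ ^ s * (ρ * ι (at A (i ℕ.∸ k′)))
      ≤⟨ *-monoˡ-≤-nonNeg′ (^-nonNeg 0≤ρ s) (<⇒≤ (growing i k′≤i i<n)) ⟩
        ρ ^ s * ι (at A i)
      ≤⟨ growing-iterate s J (ℕ.≤-trans (ℕ.m≤n+m (s ℕ.* k′) k′) [1+s]k′≤J) J<n ⟩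
        ι (at A J) ∎
      where
      i : ℕ
      i = J ℕ.∸ s ℕ.* k′
      i<n : i ℕ.< n
      i<n = ≤-<-trans (m∸n≤m J (s ℕ.* k′)) J<n
      k′≤i : k′ ℕ.≤ i
      k′≤i = subst (ℕ._≤ i) (ℕ.m+n∸n≡m k′ (s ℕ.* k′)) (ℕ.∸-monoˡ-≤ (s ℕ.* k′) [1+s]k′≤J)

    -- Going back k′ positions shrinks an element by a factor ρ, so a prefix sum is dominated by a
    -- geometric series: S_(q+1) ≤ k′ a_q (1 + 1/ρ + 1/ρ² + ⋯) = k′ a_q ρ / (ρ - 1).
    geometric-prefix : ∀ q → q ℕ.< n → ι (sum (take (suc q) A)) * (ρ - 1ℚ) ≤ ι k′ * ρ * ι (at A q)
    geometric-prefix = <-rec _ step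
      where
      step : ∀ q → (∀ {q′} → q′ ℕ.< q → q′ ℕ.< n →
                     ι (sum (take (suc q′) A)) * (ρ - 1ℚ) ≤ ι k′ * ρ * ι (at A q′)) →
             q ℕ.< n → ι (sum (take (suc q) A)) * (ρ - 1ℚ) ≤ ι k′ * ρ * ι (at A q)
      step q rec q<n with q ℕ.<? k′
      ... | yes q<k′ = begin
          ι S * (ρ - 1ℚ)
        ≤⟨ *-monoˡ-≤-nonNeg′ (ι-nonNeg S) ρ-1≤ρ ⟩
          ι S * ρ
        ≤⟨ *-monoʳ-≤-nonNeg′ 0≤ρ
             (ι-mono-≤ (ℕ.≤-trans (sum-take-≤ A↗ 0 (suc q) ℕ.≤-refl q<n) (ℕ.*-monoˡ-≤ (at A q) q<k′))) ⟩
          ι (k′ ℕ.* at A q) * ρ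
        ≡⟨ cong (_* ρ) (ι-* k′ (at A q)) ⟩
          ι k′ * ι (at A q) * ρ
        ≡⟨ solve 3 (λ x y r → x :* y :* r := x :* r :* y) refl (ι k′) (ι (at A q)) ρ ⟩
          ι k′ * ρ * ι (at A q) ∎
        where S = sum (take (suc q) A)
      ... | no q≮k′ = begin
          ι S * (ρ - 1ℚ)
        ≤⟨ *-monoʳ-≤-nonNeg′ 0≤ρ-1 (ι-mono-≤ S≤S′+k′a) ⟩
          ι (S′ ℕ.+ k′ ℕ.* a) * (ρ - 1ℚ)
        ≡⟨ cong (_* (ρ - 1ℚ)) (trans (ι-+ S′ (k′ ℕ.* a)) (cong (ι S′ +_) (ι-* k′ a))) ⟩
          (ι S′ + ι k′ * ι a) * (ρ - 1ℚ)
        ≡⟨ solve 4 (λ s K x r → (s :+ K :* x) :* r := s :* r :+ K :* x :* r) refl (ι S′) (ι k′) (ι a) (ρ - 1ℚ) ⟩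
          ι S′ * (ρ - 1ℚ) + ι k′ * ι a * (ρ - 1ℚ)
        ≤⟨ +-monoˡ-≤ _ (rec q′<q (ℕ.<-trans q′<q q<n)) ⟩
          ι k′ * ρ * ι a′ + ι k′ * ι a * (ρ - 1ℚ)
        ≤⟨ +-monoˡ-≤ _ (≤-trans (≤-reflexive (*-assoc (ι k′) ρ (ι a′)))
                                 (*-monoˡ-≤-nonNeg′ (ι-nonNeg k′) (<⇒≤ (growing q k′≤q q<n)))) ⟩
          ι k′ * ι a + ι k′ * ι a * (ρ - 1ℚ)
        ≡⟨ solve 3 (λ K x r → K :* x :+ K :* x :* (r :- con 1ℚ) := K :* r :* x) refl (ι k′) (ι a) ρ ⟩
          ι k′ * ρ * ι a ∎
        where
        k′≤q : k′ ℕ.≤ q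
        k′≤q = ℕ.≮⇒≥ q≮k′
        q′ : ℕ
        q′ = q ℕ.∸ k′
        q′+k′≡q : q′ ℕ.+ k′ ≡ q
        q′+k′≡q = ℕ.m∸n+n≡m k′≤q
        q′<q : q′ ℕ.< q
        q′<q = subst (q′ ℕ.<_) q′+k′≡q (ℕ.m<m+n q′ 1≤k′)
        S : ℕ
        S = sum (take (suc q) A)
        S′ : ℕ
        S′ = sum (take (suc q′) A)
        a : ℕ
        a = at A q
        a′ : ℕ
        a′ = at A q′
        S≤S′+k′a : S ℕ.≤ S′ ℕ.+ k′ ℕ.* a
        S≤S′+k′a = subst (λ p → sum (take p A) ℕ.≤ S′ ℕ.+ k′ ℕ.* a) (cong suc q′+k′≡q)
          (sum-take-≤ A↗ (suc q′) k′ (s≤s (ℕ.≤-reflexive q′+k′≡q)) q<n)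

    module _ (m : ℕ) (k′≤ε²[1+ε]^m : ι k′ ≤ ε * ε * (1ℚ + ε) ^ m) where
      private
        C : ℕ
        C = (2 ℕ.+ m) ℕ.* k′

      prefix-negligible : ∀ J → J ℕ.< n → ρ * ι (sum (take (suc J ℕ.∸ C) A)) ≤ ε * ι (at A J)
      prefix-negligible J J<n with C ℕ.≤? J
      ... | no C≰J rewrite ℕ.m≤n⇒m∸n≡0 (ℕ.≰⇒> C≰J) =
        ≤-trans (≤-reflexive (*-zeroʳ ρ)) (*-nonNeg 0≤ε (ι-nonNeg (at A J)))
      ... | yes C≤J rewrite ℕ.+-∸-assoc 1 C≤J =
        ρS≤εM 0<ε 1+ε≤ρ m (ι-nonNeg (sum (take (suc (J ℕ.∸ C)) A))) (ι-nonNeg (at A (J ℕ.∸ C)))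
          (geometric-prefix (J ℕ.∸ C) (≤-<-trans (m∸n≤m J C) J<n))
          (growing-iterate (2 ℕ.+ m) J C≤J J<n)
          k′≤ε²[1+ε]^m

      minWindow-≤-growing : ∀ (ℓ : Labelling k) {m₀ M} → length ℓ ≡ n → 0 ℕ.< m₀ →
        (∀ t → m₀ ℕ.≤ partSum A ℓ t) → (∀ t → partSum A ℓ t ℕ.≤ M) → ρ * ι m₀ ≡ (1ℚ + ε) * ι M →
        minWindow k C A ≤∞ fin ρ
      minWindow-≤-growing ℓ {m₀} {M} |ℓ|≡n 0<m₀ m₀≤ ≤M ρm₀≡[1+ε]M with lastLabel ℓ
      ... | inj₁ ℓ≡nothings = contradiction (ℕ.<-≤-trans 0<m₀ (subst (m₀ ℕ.≤_) no-part (m₀≤ Fin.zero))) λ ()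
        where
        no-part : partSum A ℓ Fin.zero ≡ 0
        no-part = trans (cong (λ ℓ′ → partSum A ℓ′ Fin.zero) ℓ≡nothings) (partSum-nothings A _ Fin.zero)
      ... | inj₂ (pre , t₀ , r , ℓ≡) =
        minWindow-≤-prefix-window ℓ j (ℕ.<-≤-trans (s≤s z≤n) (ℕ.*-monoʳ-≤ (2 ℕ.+ m) 1≤k′)) |ℓ|≡n J<n
          last-used 0<m₀ (λ t → subst (m₀ ℕ.≤_) (part≡prefix t) (m₀≤ t))
          (λ t → subst (ℕ._≤ M) (part≡prefix t) (≤M t))
          L<m₀ 0≤ρ M≤ρ[m₀-L]
        where
        J : ℕ
        J = length pre
        j : ℕ
        j = suc J
        L : ℕ
        L = sum (take (j ℕ.∸ C) A)
        J<n : J ℕ.< n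
        J<n = subst (J ℕ.<_) (trans (sym (length-++ pre)) (trans (cong length (sym ℓ≡)) |ℓ|≡n)) (ℕ.m<m+n J (s≤s z≤n))
        last-used : lastUsed (take j ℓ) ≡ true
        last-used = trans (cong (λ ℓ′ → lastUsed (take j ℓ′)) ℓ≡)
          (trans (cong lastUsed (take-++-∷ pre (just t₀) _)) (lastUsed-++ pre (just t₀ ∷ []) (s≤s z≤n)))
        part≡prefix : ∀ t → partSum A ℓ t ≡ partSum (take j A) (take j ℓ) t
        part≡prefix t = trans (partSum-take-drop j A ℓ t)
          (trans (cong (partSum (take j A) (take j ℓ) t ℕ.+_) unused≡0) (ℕ.+-identityʳ _))
          where
          unused≡0 : partSum (drop j A) (drop j ℓ) t ≡ 0
          unused≡0 = trans (cong (λ ℓ′ → partSum (drop j A) (drop j ℓ′) t) ℓ≡)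
            (trans (cong (λ ℓ′ → partSum (drop j A) ℓ′ t) (drop-++-∷ pre (just t₀) _)) (partSum-nothings (drop j A) r t))
        aⱼ≤M : at A J ℕ.≤ M
        aⱼ≤M = ℕ.≤-trans (subst (λ ℓ′ → at A J ℕ.≤ partSum A ℓ′ t₀) (sym ℓ≡) (at-≤-partSum A pre t₀ _))
          (≤M t₀)
        ρL≤εM : ρ * ι L ≤ ε * ι M
        ρL≤εM = ≤-trans (prefix-negligible J J<n) (*-monoˡ-≤-nonNeg′ 0≤ε (ι-mono-≤ aⱼ≤M))
        0<M : 0ℚ < ι M
        0<M = ι-mono-< {0} {M} (ℕ.<-≤-trans 0<m₀ (ℕ.≤-trans (m₀≤ t₀) (≤M t₀)))
        removal : L ℕ.< m₀ × ι M ≤ ρ * ι (m₀ ℕ.∸ L)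
        removal = prefix-removal-bound {ε} L m₀ 0<M 0≤ρ ρL≤εM ρm₀≡[1+ε]M
        L<m₀ : L ℕ.< m₀
        L<m₀ = proj₁ removal
        M≤ρ[m₀-L] : ι M ≤ ρ * ι (m₀ ℕ.∸ L)
        M≤ρ[m₀-L] = proj₂ removal

  module _ {ε : ℚ} (0<ε : 0ℚ < ε) (1≤k′ : 1 ℕ.≤ k′) (m : ℕ)
           (k′≤ε²[1+ε]^m : ι k′ ≤ ε * ε * (1ℚ + ε) ^ m) where
    private
      C : ℕ
      C = (2 ℕ.+ m) ℕ.* k′

    module _ (ℓ : Labelling k) (|ℓ|≡n : length ℓ ≡ n) {m′ : ℕ} (minL≡1+m′ : minL (parts A ℓ) ≡ suc m′) where
      private
        M : ℕ
        M = maxL (parts A ℓ)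
        m₀ : ℕ
        m₀ = suc m′
        ρ : ℚ
        ρ = (1ℚ + ε) * (ℤ.+ M / m₀)
        0≤1+ε : 0ℚ ≤ 1ℚ + ε
        0≤1+ε = +-mono-≤ (ι-nonNeg 1) (<⇒≤ 0<ε)
        m₀≤ : ∀ t → m₀ ℕ.≤ partSum A ℓ t
        m₀≤ t = subst (ℕ._≤ partSum A ℓ t) minL≡1+m′ (minL-≤-partSum A ℓ t)
        1+ε≤ρ : 1ℚ + ε ≤ ρ
        1+ε≤ρ = ≤-trans (≤-reflexive (sym (*-identityʳ (1ℚ + ε))))
          (*-monoˡ-≤-nonNeg′ 0≤1+ε (1≤M/d (ℕ.≤-trans (m₀≤ Fin.zero) (partSum-≤-maxL A ℓ Fin.zero))))
        0≤ρ : 0ℚ ≤ ρ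
        0≤ρ = ≤-trans 0≤1+ε 1+ε≤ρ
        ρm₀≡[1+ε]M : ρ * ι m₀ ≡ (1ℚ + ε) * ι M
        ρm₀≡[1+ε]M = trans (*-assoc (1ℚ + ε) (ℤ.+ M / m₀) (ι m₀)) (cong ((1ℚ + ε) *_) (/-*-cancel M m′))
        k≤C : k ℕ.≤ C
        k≤C = ℕ.≤-trans (ℕ.+-monoˡ-≤ k′ 1≤k′) (ℕ.+-monoʳ-≤ k′ (ℕ.m≤m+n k′ (m ℕ.* k′)))
        flat? : ∀ i → Dec (k′ ℕ.≤ i × ι (at A i) ≤ ρ * ι (at A (i ℕ.∸ k′)))
        flat? i = (k′ ℕ.≤? i) ×-dec (ι (at A i) ≤? ρ * ι (at A (i ℕ.∸ k′)))

      minWindow-≤-ρ : minWindow k C A ≤∞ fin ρ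
      minWindow-≤-ρ with ℕ.anyUpTo? flat? n
      ... | yes (i , i<n , k′≤i , flat) = minWindow-≤-flat i k≤C 0≤ρ k′≤i i<n flat
      ... | no no-flat = minWindow-≤-growing 0<ε 1+ε≤ρ 1≤k′ growing m k′≤ε²[1+ε]^m ℓ |ℓ|≡n (s≤s z≤n)
                           m₀≤ (partSum-≤-maxL A ℓ) ρm₀≡[1+ε]M
        where
        growing : ∀ i → k′ ℕ.≤ i → i ℕ.< n → ρ * ι (at A (i ℕ.∸ k′)) < ι (at A i)
        growing i k′≤i i<n = ≰⇒> λ flat → no-flat (i , i<n , k′≤i , flat)

    minWindow-≤-[1+ε]ratio : ∀ (ℓ : Labelling k) → length ℓ ≡ n → minWindow k C A ≤∞ scale (1ℚ + ε) (ratio k A ℓ)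
    minWindow-≤-[1+ε]ratio ℓ |ℓ|≡n with minL (parts A ℓ) in minL≡
    ... | zero = x≤∞∞
    ... | suc m′ = minWindow-≤-ρ ℓ |ℓ|≡n minL≡

open import Data.Nat using (ℕ; suc; _*_; _∸_; _≤_; _<_)
open import Data.Rational using (ℚ; 0ℚ; 1ℚ) renaming (_<_ to _<ℚ_; _+_ to _+ℚ_)
open import Data.List using (List)
open import Data.List.Relation.Unary.All using (All)
open import Data.List.Relation.Unary.Linked using (Linked)
open import Data.Product using (_×_)
open import Data.Rational using () renaming (_≤_ to _≤ℚ_; _*_ to _*ℚ_)
import Data.Nat.Properties as ℕ
import Data.Rational.Properties as ℚ

lemma26 : (k : ℕ) → 2 ≤ k →
    (A : List ℕ) → Linked _≤_ A → All (0 <_) A →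
    (ε : ℚ) (0<ε : 0ℚ <ℚ ε) → ε <ℚ 1ℚ →
    (m : ℕ) → IsCeilX k ε 0<ε m →
    let c = suc m
        C = suc c * (k ∸ 1)
    in (OPT k A ≤∞ minWindow k C A)
       × (minWindow k C A ≤∞ scale (1ℚ +ℚ ε) (OPT k A))
lemma26 k@(suc (suc k″)) (s≤s (s≤s z≤n)) A A↗ A⁺ ε 0<ε _ m (ln-bound , _) =
  OPT-≤-minWindow k (suc (suc m) * (k ∸ 1)) A ,
  ≤-scale-OPT k A (1ℚ +ℚ ε) (minWindow-≤-[1+ε]ratio A↗ A⁺ 0<ε (s≤s z≤n) m k′≤ε²[1+ε]^m)
  where
  k′≤ε²[1+ε]^m : ι (suc k″) ≤ℚ ε *ℚ ε *ℚ (1ℚ +ℚ ε) ^ m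
  k′≤ε²[1+ε]^m = ℚ.≤-trans (ι-mono-≤ (ℕ.m≤m+n (suc k″) (suc k″ ℕ.+ 0)))
    (LnBoundLe⇒2[k-1]≤ε²[1+ε]^m 0<ε k m ln-bound)
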